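{- Let $k\geq 6$ be an even integer. Let $S_k:=\{n\in\mathbb N: n\equiv 0,1,-1 \pmod{k-2}\}$ and let $P_k:=\{n((k-2)n\pm(k-4))/2 : n\in\mathbb N\}$. Then for every integer $n\geq 0$, \[ p_{S_k}(n)=(-1)^n\sum_{\substack{c\in\mathcal C_{P_k}\\ |c|=n}}(-1)^{\ell(c)}, \] where $p_{S_k}(n)$ is the number of partitions of $n$ all of whose parts lie in $S_k$.
   Context: $\mathbb N$ denotes the positive integers. $P_k$ is the set of positive extended $k$-gonal numbers (both signs $\pm$ allowed). A composition is an ordered finite sequence of positive integers (its parts), the empty composition included; $|c|$ is the sum of the parts and $\ell(c)$ the number of parts; $\mathcal C_{S}$ is the set of compositions all of whose parts lie in $S$. For $S\subseteq\mathbb N$, $p_S(n)$ is the number of (unordered) partitions of $n$ with all parts in $S$, with $p_S(0)=1$. -}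

module Defs where

open import Data.Nat using (ℕ; zero; suc; _+_; _*_; _∸_; _≤_; _≥_)
open import Data.Nat.Divisibility using (_∣_)
open import Data.Integer using (ℤ; -1ℤ; 0ℤ) renaming (_+_ to _+ℤ_; _^_ to _^ℤ_)
open import Data.List using (List; length; map; foldr)
open import Data.Nat.ListAction using (sum)
open import Relation.Binary.PropositionalEquality using (_≡_)
open import Data.List.Relation.Unary.All using (All)
open import Data.List.Relation.Unary.Linked using (Linked)
open import Data.List.Relation.Unary.Unique.Propositional using (Unique)
open import Data.List.Membership.Propositional using (_∈_)
open import Data.Product using (Σ; ∃; _×_)
open import Data.Sum using (_⊎_)
open import Function.Bundles using (_⇔_)

S : ℕ → ℕ → Set
S k n = (1 ≤ n) × ((k ∸ 2) ∣ n ⊎ (k ∸ 2) ∣ (n ∸ 1) ⊎ (k ∸ 2) ∣ (n + 1))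

P : ℕ → ℕ → Set
P k x = ∃ λ m → (1 ≤ m) ×
          ((2 * x ≡ m * ((k ∸ 2) * m + (k ∸ 4))) ⊎
           (2 * x ≡ m * ((k ∸ 2) * m ∸ (k ∸ 4))))

-- A partition of n with parts in A: a non-increasing list of parts
-- (canonical representative of the multiset), all in A, summing to n.
IsPartition : (ℕ → Set) → ℕ → List ℕ → Set
IsPartition A n xs = Linked _≥_ xs × All A xs × sum xs ≡ n

IsComposition : (ℕ → Set) → ℕ → List ℕ → Set
IsComposition A n xs = All A xs × sum xs ≡ n

-- L is a duplicate-free list containing exactly the objects satisfying Q
-- (so length L is the cardinality of {x | Q x}).
Enumerates : (List ℕ → Set) → List (List ℕ) → Set
Enumerates Q L = Unique L × (∀ xs → (xs ∈ L) ⇔ Q xs)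

signedCount : List (List ℕ) → ℤ
signedCount L = foldr _+ℤ_ 0ℤ (map (λ c → -1ℤ ^ℤ length c) L)

{-# OPTIONS --safe #-}
module Submission where

-- Let w = k - 2. Jacobi's triple product gives
--   ∏_{s ∈ S_k} (1 - q^s) = ∑_{m ∈ ℤ} (-1)^m q^(m (w m - (w - 2)) / 2) = 1 + ∑_{x ∈ P_k} (-q)^x,
-- the last step because w is even, so that x and m have the same parity. Hence
--   ∑ p_{S_k}(n) q^n = 1 / (1 + ∑_{x ∈ P_k} (-q)^x) = ∑_{c ∈ C_{P_k}} (-1)^ℓ(c) (-q)^|c|,
-- and coefficientwise both sides satisfy the recurrence f n + ∑_{x ∈ P_k} (-1)^x f (n - x) = [n = 0],
-- which determines f. Only the triple product modulo q^(N+1) is needed. There it follows from the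
-- finite q-binomial theorem for ∏_{i<K} (1 - q^(c + i w)) with a negative start c, after multiplying
-- by (q^w; q^w)_N, which turns every Gaussian binomial coefficient into 1 modulo q^(N+1).

open import Data.Nat using (ℕ)

module Series where
  open import Data.Nat as ℕ using (ℕ; zero; suc)
  open import Data.Integer
    using (ℤ; +_; -[1+_]; 0ℤ; 1ℤ; -1ℤ; _+_; _*_; -_; _-_; _<_; _≤_; +<+; +≤+; -<+; _^_; ∣_∣)
  import Data.Integer.Properties as ℤP
  import Data.Nat.Properties as ℕP
  open import Data.Integer.Tactic.RingSolver using (solve-∀)
  open import Relation.Binary.PropositionalEquality
  import Relation.Binary.Reasoning.Setoid
  open import Data.List using (List; []; _∷_)
  open import Data.List.Relation.Unary.All using (All; []; _∷_)
  open import Relation.Nullary using (yes; no)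

  sumℤ : ℕ → (ℕ → ℤ) → ℤ
  sumℤ zero g = 0ℤ
  sumℤ (suc K) g = sumℤ K g + g K

  sumℤ-cong-< : ∀ K {g h : ℕ → ℤ} → (∀ i → i ℕ.< K → g i ≡ h i) → sumℤ K g ≡ sumℤ K h
  sumℤ-cong-< zero e = refl
  sumℤ-cong-< (suc K) e =
    cong₂ _+_ (sumℤ-cong-< K (λ i i<K → e i (ℕP.m<n⇒m<1+n i<K))) (e K (ℕP.n<1+n K))

  sumℤ-cong : ∀ K {g h : ℕ → ℤ} → (∀ i → g i ≡ h i) → sumℤ K g ≡ sumℤ K h
  sumℤ-cong K e = sumℤ-cong-< K (λ i _ → e i)

  sumℤ-+ : ∀ K (g h : ℕ → ℤ) → sumℤ K (λ i → g i + h i) ≡ sumℤ K g + sumℤ K h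
  sumℤ-+ zero g h = refl
  sumℤ-+ (suc K) g h =
    trans (cong (_+ (g K + h K)) (sumℤ-+ K g h)) (swap (sumℤ K g) (sumℤ K h) (g K) (h K))
    where
    swap : ∀ a b c d → (a + b) + (c + d) ≡ (a + c) + (b + d)
    swap = solve-∀

  *-sumℤ : ∀ K x (g : ℕ → ℤ) → x * sumℤ K g ≡ sumℤ K (λ i → x * g i)
  *-sumℤ zero x g = ℤP.*-zeroʳ x
  *-sumℤ (suc K) x g =
    trans (ℤP.*-distribˡ-+ x (sumℤ K g) (g K)) (cong (_+ (x * g K)) (*-sumℤ K x g))

  neg-sumℤ : ∀ K (g : ℕ → ℤ) → - sumℤ K g ≡ sumℤ K (λ i → - g i)
  neg-sumℤ K g =
    trans (sym (ℤP.-1*i≡-i _)) (trans (*-sumℤ K -1ℤ g) (sumℤ-cong K (λ i → ℤP.-1*i≡-i (g i))))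

  sumℤ-suc : ∀ K (g : ℕ → ℤ) → sumℤ (suc K) g ≡ g 0 + sumℤ K (λ i → g (suc i))
  sumℤ-suc zero g = ℤP.+-comm 0ℤ (g 0)
  sumℤ-suc (suc K) g = trans (cong (_+ g (suc K)) (sumℤ-suc K g)) (ℤP.+-assoc (g 0) _ _)

  sumℤ-zero : ∀ K (g : ℕ → ℤ) → (∀ i → i ℕ.< K → g i ≡ 0ℤ) → sumℤ K g ≡ 0ℤ
  sumℤ-zero K g e = trans (sumℤ-cong-< K e) (sum-0 K)
    where
    sum-0 : ∀ K → sumℤ K (λ _ → 0ℤ) ≡ 0ℤ
    sum-0 zero = refl
    sum-0 (suc K) = trans (ℤP.+-identityʳ _) (sum-0 K)

  -- formal Laurent series in q, as the map z ↦ coefficient of q^z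
  Series : Set
  Series = ℤ → ℤ

  infix 4 _≈_
  _≈_ : Series → Series → Set
  _≈_ = _≗_

  ≈-refl : ∀ {f} → f ≈ f
  ≈-refl z = refl

  ≈-sym : ∀ {f g} → f ≈ g → g ≈ f
  ≈-sym e z = sym (e z)

  ≈-trans : ∀ {f g h} → f ≈ g → g ≈ h → f ≈ h
  ≈-trans e e′ z = trans (e z) (e′ z)

  module ≈-Reasoning = Relation.Binary.Reasoning.Setoid (ℤ →-setoid ℤ)

  𝟘 : Series
  𝟘 _ = 0ℤ

  𝟙 : Series
  𝟙 (+ zero) = 1ℤ
  𝟙 (+ suc _) = 0ℤ
  𝟙 -[1+ _ ] = 0ℤ

  infixl 6 _⊕_
  _⊕_ : Series → Series → Series
  (f ⊕ g) z = f z + g z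

  ⊖_ : Series → Series
  (⊖ f) z = - f z

  infixr 7 _⊙_
  _⊙_ : ℤ → Series → Series
  (x ⊙ f) z = x * f z

  shift : ℤ → Series → Series
  shift e f z = f (z - e)

  -- Δ c f = (1 - q^c) f
  Δ : ℤ → Series → Series
  Δ c f z = f z - f (z - c)

  sumₛ : ℕ → (ℕ → Series) → Series
  sumₛ K F z = sumℤ K (λ i → F i z)

  ⊕-cong : ∀ {f f′ g g′} → f ≈ f′ → g ≈ g′ → f ⊕ g ≈ f′ ⊕ g′
  ⊕-cong e e′ z = cong₂ _+_ (e z) (e′ z)

  ⊙-cong : ∀ x {f g} → f ≈ g → x ⊙ f ≈ x ⊙ g
  ⊙-cong x e z = cong (x *_) (e z)

  shift-cong : ∀ e {f g} → f ≈ g → shift e f ≈ shift e g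
  shift-cong e eq z = eq (z - e)

  Δ-cong : ∀ c {f g} → f ≈ g → Δ c f ≈ Δ c g
  Δ-cong c e z = cong₂ _-_ (e z) (e (z - c))

  Δ-congˡ : ∀ {c c′} f → c ≡ c′ → Δ c f ≈ Δ c′ f
  Δ-congˡ f refl z = refl

  sumₛ-cong : ∀ K {F G : ℕ → Series} → (∀ i → F i ≈ G i) → sumₛ K F ≈ sumₛ K G
  sumₛ-cong K e z = sumℤ-cong K (λ i → e i z)

  sumₛ-suc : ∀ K (F : ℕ → Series) → sumₛ (suc K) F ≈ F 0 ⊕ sumₛ K (λ i → F (suc i))
  sumₛ-suc K F z = sumℤ-suc K (λ i → F i z)

  sumₛ-⊕ : ∀ K (F G : ℕ → Series) → sumₛ K (λ i → F i ⊕ G i) ≈ sumₛ K F ⊕ sumₛ K G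
  sumₛ-⊕ K F G z = sumℤ-+ K (λ i → F i z) (λ i → G i z)

  ⊕-identityʳ : ∀ f → f ⊕ 𝟘 ≈ f
  ⊕-identityʳ f z = ℤP.+-identityʳ (f z)

  Δ-⊕ : ∀ c f g → Δ c (f ⊕ g) ≈ Δ c f ⊕ Δ c g
  Δ-⊕ c f g z = lem (f z) (g z) (f (z - c)) (g (z - c))
    where
    lem : ∀ a b c d → (a + b) - (c + d) ≡ (a - c) + (b - d)
    lem = solve-∀

  Δ-⊖ : ∀ c f → Δ c (⊖ f) ≈ ⊖ Δ c f
  Δ-⊖ c f z = lem (f z) (f (z - c))
    where
    lem : ∀ a b → (- a) - (- b) ≡ - (a - b)
    lem = solve-∀

  Δ-⊙ : ∀ c x f → Δ c (x ⊙ f) ≈ x ⊙ Δ c f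
  Δ-⊙ c x f z = lem x (f z) (f (z - c))
    where
    lem : ∀ x a b → x * a - x * b ≡ x * (a - b)
    lem = solve-∀

  private
    sub-comm : ∀ z a b → z - a - b ≡ z - b - a
    sub-comm = solve-∀

  Δ-shift : ∀ c e f → Δ c (shift e f) ≈ shift e (Δ c f)
  Δ-shift c e f z = cong (λ t → f (z - e) - f t) (sub-comm z c e)

  Δ-sumₛ : ∀ c K (F : ℕ → Series) → Δ c (sumₛ K F) ≈ sumₛ K (λ i → Δ c (F i))
  Δ-sumₛ c K F z =
    trans (cong (λ t → sumₛ K F z + t) (neg-sumℤ K _)) (sym (sumℤ-+ K (λ i → F i z) (λ i → - F i (z - c))))

  Δ-comm : ∀ c d f → Δ c (Δ d f) ≈ Δ d (Δ c f)
  Δ-comm c d f z =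
    trans (cong (λ t → f z - f (z - d) - (f (z - c) - f t)) (sub-comm z c d))
          (lem (f z) (f (z - d)) (f (z - c)) (f (z - d - c)))
    where
    lem : ∀ a b c d → a - b - (c - d) ≡ a - c - (b - d)
    lem = solve-∀

  Δ-neg : ∀ d f → Δ (- d) f ≈ ⊖ shift (- d) (Δ d f)
  Δ-neg d f z =
    trans (lem (f z) (f (z - - d))) (cong (λ t → - (f (z - - d) - f t)) (sym (cancel z d)))
    where
    cancel : ∀ z d → z - - d - d ≡ z
    cancel = solve-∀
    lem : ∀ a b → a - b ≡ - (b - a)
    lem = solve-∀

  infix 4 _≈[<_]_
  _≈[<_]_ : Series → ℤ → Series → Set
  f ≈[< u ] g = ∀ z → z < u → f z ≡ g z

  IsPowerSeries : Series → Set
  IsPowerSeries f = ∀ z → z < 0ℤ → f z ≡ 0ℤ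

  ≈⇒≈[<] : ∀ {u f g} → f ≈ g → f ≈[< u ] g
  ≈⇒≈[<] e z _ = e z

  ≈[<]-trans : ∀ {u f g h} → f ≈[< u ] g → g ≈[< u ] h → f ≈[< u ] h
  ≈[<]-trans e e′ z p = trans (e z p) (e′ z p)

  ≈[<]-sym : ∀ {u f g} → f ≈[< u ] g → g ≈[< u ] f
  ≈[<]-sym e z p = sym (e z p)

  ≈[<]-mono : ∀ {u v f g} → v ≤ u → f ≈[< u ] g → f ≈[< v ] g
  ≈[<]-mono v≤u e z p = e z (ℤP.<-≤-trans p v≤u)

  ≈[<]-⊕ : ∀ {u f f′ g g′} → f ≈[< u ] f′ → g ≈[< u ] g′ → f ⊕ g ≈[< u ] f′ ⊕ g′
  ≈[<]-⊕ e e′ z p = cong₂ _+_ (e z p) (e′ z p)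

  ≈[<]-⊖ : ∀ {u f g} → f ≈[< u ] g → ⊖ f ≈[< u ] ⊖ g
  ≈[<]-⊖ e z p = cong -_ (e z p)

  ≈[<]-⊙ : ∀ {u} x {f g} → f ≈[< u ] g → x ⊙ f ≈[< u ] x ⊙ g
  ≈[<]-⊙ x e z p = cong (x *_) (e z p)

  ≈[<]-sumₛ : ∀ {u} K {F G : ℕ → Series} →
              (∀ i → i ℕ.< K → F i ≈[< u ] G i) → sumₛ K F ≈[< u ] sumₛ K G
  ≈[<]-sumₛ K e z p = sumℤ-cong-< K (λ i i<K → e i i<K z p)

  <+⇒-< : ∀ z u e → z < u + e → z - e < u
  <+⇒-< z u e p = subst (z - e <_) (cancel u e) (ℤP.+-monoˡ-< (- e) p)
    where
    cancel : ∀ u e → u + e - e ≡ u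
    cancel = solve-∀

  ≥0⇒-≤ : ∀ z c → 0ℤ ≤ c → z - c ≤ z
  ≥0⇒-≤ z c p = subst (z - c ≤_) (ℤP.+-identityʳ z) (ℤP.+-monoʳ-≤ z (ℤP.neg-mono-≤ p))

  ≈[<]-shift : ∀ {u} e {f g} → f ≈[< u ] g → shift e f ≈[< u + e ] shift e g
  ≈[<]-shift {u} e eq z p = eq (z - e) (<+⇒-< z u e p)

  ≈[<]-Δ : ∀ {u} c {f g} → 0ℤ ≤ c → f ≈[< u ] g → Δ c f ≈[< u ] Δ c g
  ≈[<]-Δ c c≥0 e z p = cong₂ _-_ (e z p) (e (z - c) (ℤP.≤-<-trans (≥0⇒-≤ z c c≥0) p))

  <⇒-<0 : ∀ z c → z < c → z - c < 0ℤ
  <⇒-<0 z c p = <+⇒-< z 0ℤ c (subst (z <_) (sym (ℤP.+-identityˡ c)) p)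

  Δ≈[<]id : ∀ c f → IsPowerSeries f → Δ c f ≈[< c ] f
  Δ≈[<]id c f s z p = trans (cong (λ t → f z - t) (s (z - c) (<⇒-<0 z c p))) (ℤP.+-identityʳ (f z))

  shift≈[<]𝟘 : ∀ e f → IsPowerSeries f → shift e f ≈[< e ] 𝟘
  shift≈[<]𝟘 e f s z p = s (z - e) (<⇒-<0 z e p)

  𝟙-isPowerSeries : IsPowerSeries 𝟙
  𝟙-isPowerSeries -[1+ _ ] _ = refl
  𝟙-isPowerSeries (+ _) (+<+ ())

  ⊕-isPowerSeries : ∀ {f g} → IsPowerSeries f → IsPowerSeries g → IsPowerSeries (f ⊕ g)
  ⊕-isPowerSeries s s′ z p = cong₂ _+_ (s z p) (s′ z p)

  ⊖-isPowerSeries : ∀ {f} → IsPowerSeries f → IsPowerSeries (⊖ f)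
  ⊖-isPowerSeries s z p = cong -_ (s z p)

  ⊙-isPowerSeries : ∀ x {f} → IsPowerSeries f → IsPowerSeries (x ⊙ f)
  ⊙-isPowerSeries x s z p = trans (cong (x *_) (s z p)) (ℤP.*-zeroʳ x)

  Δ-isPowerSeries : ∀ c {f} → 0ℤ ≤ c → IsPowerSeries f → IsPowerSeries (Δ c f)
  Δ-isPowerSeries c c≥0 s z p = cong₂ _-_ (s z p) (s (z - c) (ℤP.≤-<-trans (≥0⇒-≤ z c c≥0) p))

  shift-isPowerSeries : ∀ e {f} → 0ℤ ≤ e → IsPowerSeries f → IsPowerSeries (shift e f)
  shift-isPowerSeries e e≥0 s z p = s (z - e) (ℤP.≤-<-trans (≥0⇒-≤ z e e≥0) p)

  sumₛ-isPowerSeries : ∀ K {F : ℕ → Series} → (∀ i → IsPowerSeries (F i)) → IsPowerSeries (sumₛ K F)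
  sumₛ-isPowerSeries K s z p = sumℤ-zero K _ (λ i _ → s i z p)

  Δ-sumₛ-split : ∀ c K (X : ℕ → Series) → X (suc K) ≈ 𝟘 →
                 Δ c (sumₛ (suc K) X) ≈ X 0 ⊕ sumₛ (suc K) (λ j → ⊖ shift c (X j) ⊕ X (suc j))
  Δ-sumₛ-split c K X top z = begin
      S z - S (z - c)
    ≡⟨ cong (_- S (z - c)) (trans extend (sumℤ-suc (suc K) (λ j → X j z))) ⟩
      X 0 z + A - S (z - c)
    ≡⟨ cong (λ t → X 0 z + A + t) (neg-sumℤ (suc K) (λ j → X j (z - c))) ⟩
      X 0 z + A + B
    ≡⟨ ℤP.+-assoc (X 0 z) A B ⟩
      X 0 z + (A + B)
    ≡⟨ cong (λ t → X 0 z + t) (trans (ℤP.+-comm A B) (sym (sumℤ-+ (suc K) _ _))) ⟩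
      (X 0 ⊕ sumₛ (suc K) (λ j → ⊖ shift c (X j) ⊕ X (suc j))) z
    ∎
    where
    open ≡-Reasoning
    S = sumₛ (suc K) X
    A = sumℤ (suc K) (λ j → X (suc j) z)
    B = sumℤ (suc K) (λ j → - X j (z - c))
    extend : S z ≡ sumℤ (suc (suc K)) (λ j → X j z)
    extend = sym (trans (cong (λ t → S z + t) (top z)) (ℤP.+-identityʳ (S z)))

  Δ⊕shift : ∀ e f → Δ e f ⊕ shift e f ≈ f
  Δ⊕shift e f z = lem (f z) (f (z - e))
    where
    lem : ∀ a b → a - b + b ≡ a
    lem = solve-∀

  -- The diagonals of H are constant, so the terms H B j with j ≥ B are the H 0 (j - B),
  -- and those with j < B are the H (B - j) 0.
  sumₛ-reindex : ∀ (H : ℕ → ℕ → Series) → (∀ B j → H (suc B) (suc j) ≈ H B j) → ∀ B A →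
                 sumₛ (B ℕ.+ suc A) (H B) ≈ sumₛ (suc A) (H 0) ⊕ sumₛ B (λ i → H (suc i) 0)
  sumₛ-reindex H diag zero A z = sym (ℤP.+-identityʳ _)
  sumₛ-reindex H diag (suc B) A z =
    trans (sumₛ-suc (B ℕ.+ suc A) (H (suc B)) z)
    (trans (cong (λ t → H (suc B) 0 z + t)
                 (trans (sumₛ-cong (B ℕ.+ suc A) (diag B) z) (sumₛ-reindex H diag B A z)))
           (lem (H (suc B) 0 z) (sumₛ (suc A) (H 0) z) (sumₛ B (λ i → H (suc i) 0) z)))
    where
    lem : ∀ h a b → h + (a + b) ≡ a + (b + h)
    lem = solve-∀

  ⊙-shift-sumₛ : ∀ x s L (e y : ℕ → ℤ) (F : ℕ → Series) →
                 x ⊙ shift s (sumₛ L (λ j → y j ⊙ shift (e j) (F j)))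
                 ≈ sumₛ L (λ j → (x * y j) ⊙ shift (s + e j) (F j))
  ⊙-shift-sumₛ x s L e y F z =
    trans (*-sumℤ L x _)
          (sumℤ-cong L (λ j → trans (sym (ℤP.*-assoc x (y j) _))
                                    (cong (λ t → (x * y j) * F j t) (lem z s (e j)))))
    where
    lem : ∀ z s e → z - s - e ≡ z - (s + e)
    lem = solve-∀

  Δ∏ : List ℕ → Series → Series
  Δ∏ [] f = f
  Δ∏ (x ∷ xs) f = Δ (+ x) (Δ∏ xs f)

  Δ∏-cong : ∀ xs {f g} → f ≈ g → Δ∏ xs f ≈ Δ∏ xs g
  Δ∏-cong [] e = e
  Δ∏-cong (x ∷ xs) e = Δ-cong (+ x) (Δ∏-cong xs e)

  Δ∏-⊕ : ∀ xs f g → Δ∏ xs (f ⊕ g) ≈ Δ∏ xs f ⊕ Δ∏ xs g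
  Δ∏-⊕ [] f g = ≈-refl
  Δ∏-⊕ (x ∷ xs) f g = ≈-trans (Δ-cong (+ x) (Δ∏-⊕ xs f g)) (Δ-⊕ (+ x) (Δ∏ xs f) (Δ∏ xs g))

  Δ∏-⊖ : ∀ xs f → Δ∏ xs (⊖ f) ≈ ⊖ Δ∏ xs f
  Δ∏-⊖ [] f = ≈-refl
  Δ∏-⊖ (x ∷ xs) f = ≈-trans (Δ-cong (+ x) (Δ∏-⊖ xs f)) (Δ-⊖ (+ x) (Δ∏ xs f))

  Δ∏-⊙ : ∀ xs y f → Δ∏ xs (y ⊙ f) ≈ y ⊙ Δ∏ xs f
  Δ∏-⊙ [] y f = ≈-refl
  Δ∏-⊙ (x ∷ xs) y f = ≈-trans (Δ-cong (+ x) (Δ∏-⊙ xs y f)) (Δ-⊙ (+ x) y (Δ∏ xs f))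

  Δ∏-shift : ∀ xs e f → Δ∏ xs (shift e f) ≈ shift e (Δ∏ xs f)
  Δ∏-shift [] e f = ≈-refl
  Δ∏-shift (x ∷ xs) e f = ≈-trans (Δ-cong (+ x) (Δ∏-shift xs e f)) (Δ-shift (+ x) e (Δ∏ xs f))

  Δ∏-sumₛ : ∀ xs K F → Δ∏ xs (sumₛ K F) ≈ sumₛ K (λ i → Δ∏ xs (F i))
  Δ∏-sumₛ [] K F = ≈-refl
  Δ∏-sumₛ (x ∷ xs) K F =
    ≈-trans (Δ-cong (+ x) (Δ∏-sumₛ xs K F)) (Δ-sumₛ (+ x) K (λ i → Δ∏ xs (F i)))

  Δ∏-Δ : ∀ xs d f → Δ∏ xs (Δ d f) ≈ Δ d (Δ∏ xs f)
  Δ∏-Δ [] d f = ≈-refl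
  Δ∏-Δ (x ∷ xs) d f = ≈-trans (Δ-cong (+ x) (Δ∏-Δ xs d f)) (Δ-comm (+ x) d (Δ∏ xs f))

  Δ∏-𝟘 : ∀ xs → Δ∏ xs 𝟘 ≈ 𝟘
  Δ∏-𝟘 [] = ≈-refl
  Δ∏-𝟘 (x ∷ xs) = ≈-trans (Δ-cong (+ x) (Δ∏-𝟘 xs)) (λ z → refl)

  Δ∏-⊙-shift-sumₛ : ∀ xs x s L (e y : ℕ → ℤ) (F : ℕ → Series) →
                    Δ∏ xs (x ⊙ shift s (sumₛ L (λ j → y j ⊙ shift (e j) (F j))))
                    ≈ sumₛ L (λ j → (x * y j) ⊙ shift (s + e j) (Δ∏ xs (F j)))
  Δ∏-⊙-shift-sumₛ xs x s L e y F = begin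
      Δ∏ xs (x ⊙ shift s (sumₛ L G))
    ≈⟨ Δ∏-⊙ xs x _ ⟩
      x ⊙ Δ∏ xs (shift s (sumₛ L G))
    ≈⟨ ⊙-cong x (Δ∏-shift xs s _) ⟩
      x ⊙ shift s (Δ∏ xs (sumₛ L G))
    ≈⟨ ⊙-cong x (shift-cong s (Δ∏-sumₛ xs L G)) ⟩
      x ⊙ shift s (sumₛ L (λ j → Δ∏ xs (G j)))
    ≈⟨ ⊙-cong x (shift-cong s (sumₛ-cong L (λ j →
         ≈-trans (Δ∏-⊙ xs (y j) _) (⊙-cong (y j) (Δ∏-shift xs (e j) (F j)))))) ⟩
      x ⊙ shift s (sumₛ L (λ j → y j ⊙ shift (e j) (Δ∏ xs (F j))))
    ≈⟨ ⊙-shift-sumₛ x s L e y (λ j → Δ∏ xs (F j)) ⟩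
      sumₛ L (λ j → (x * y j) ⊙ shift (s + e j) (Δ∏ xs (F j)))
    ∎
    where
    open ≈-Reasoning
    G = λ j → y j ⊙ shift (e j) (F j)

  Δ∏-isPowerSeries : ∀ xs {f} → IsPowerSeries f → IsPowerSeries (Δ∏ xs f)
  Δ∏-isPowerSeries [] s = s
  Δ∏-isPowerSeries (x ∷ xs) s = Δ-isPowerSeries (+ x) (+≤+ ℕ.z≤n) (Δ∏-isPowerSeries xs s)

  Δ-cancel : ∀ d Z u → IsPowerSeries Z → Δ (+ suc d) Z ≈[< u ] 𝟘 → Z ≈[< u ] 𝟘
  Δ-cancel d Z u Z⁺ ΔZ≈0 z z<u = below (suc ∣ z ∣) z z<u (z<1+∣z∣ z)
    where
    z<1+∣z∣ : ∀ z → z < + suc ∣ z ∣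
    z<1+∣z∣ (+ n) = +<+ (ℕP.n<1+n n)
    z<1+∣z∣ -[1+ n ] = -<+
    below : ∀ t z → z < u → z < + t → Z z ≡ 0ℤ
    below zero z _ z<0 = Z⁺ z z<0
    below (suc t) z z<u z<1+t = begin
        Z z                                 ≡⟨ lem (Z z) (Z (z - + suc d)) ⟩
        Δ (+ suc d) Z z + Z (z - + suc d)   ≡⟨ cong₂ _+_ (ΔZ≈0 z z<u) (below t (z - + suc d) z-c<u z-c<t) ⟩
        0ℤ + 0ℤ                             ∎
      where
      open ≡-Reasoning
      lem : ∀ x y → x ≡ (x - y) + y
      lem = solve-∀
      z-c<u : z - + suc d < u
      z-c<u = ℤP.≤-<-trans (≥0⇒-≤ z (+ suc d) (+≤+ ℕ.z≤n)) z<u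
      z-c<t : z - + suc d < + t
      z-c<t = <+⇒-< z (+ t) (+ suc d) (ℤP.<-≤-trans z<1+t (subst (+ suc t ≤_) (ℤP.pos-+ t (suc d))
                (+≤+ (ℕP.≤-trans (ℕP.≤-reflexive (ℕP.+-comm 1 t)) (ℕP.+-monoʳ-≤ t (ℕ.s≤s ℕ.z≤n))))))

  Δ∏-cancel : ∀ xs → All (1 ℕ.≤_) xs → ∀ Y u → IsPowerSeries Y →
              Δ∏ xs Y ≈[< u ] 𝟘 → Y ≈[< u ] 𝟘
  Δ∏-cancel [] _ Y u Y⁺ eq = eq
  Δ∏-cancel (suc d ∷ xs) (_ ∷ xs≥1) Y u Y⁺ eq =
    Δ∏-cancel xs xs≥1 Y u Y⁺ (Δ-cancel d (Δ∏ xs Y) u (Δ∏-isPowerSeries xs Y⁺) eq)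

  toSeries : (ℕ → ℤ) → Series
  toSeries g (+ m) = g m
  toSeries g -[1+ _ ] = 0ℤ

  toSeries-isPowerSeries : ∀ g → IsPowerSeries (toSeries g)
  toSeries-isPowerSeries g -[1+ _ ] _ = refl
  toSeries-isPowerSeries g (+ _) (+<+ ())

  toSeries-sub-≤ : ∀ g n E → E ℕ.≤ n → toSeries g (+ n - + E) ≡ g (n ℕ.∸ E)
  toSeries-sub-≤ g n E E≤n = cong (toSeries g) (trans (ℤP.m-n≡m⊖n n E) (ℤP.⊖-≥ E≤n))

  toSeries-sub-> : ∀ g n E → n ℕ.< E → toSeries g (+ n - + E) ≡ 0ℤ
  toSeries-sub-> g n E n<E = trans (cong (toSeries g) (trans (ℤP.m-n≡m⊖n n E) (ℤP.⊖-< n<E)))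
                                   (negative (E ℕ.∸ n) (ℕP.m<n⇒0<n∸m n<E))
    where
    negative : ∀ m → 1 ℕ.≤ m → toSeries g (- + m) ≡ 0ℤ
    negative (suc m) _ = refl

  toSeries-sub-cong : ∀ g h n E → 1 ℕ.≤ E → (∀ m → m ℕ.< n → g m ≡ h m) →
                      toSeries g (+ n - + E) ≡ toSeries h (+ n - + E)
  toSeries-sub-cong g h n E E≥1 g≡h with E ℕ.≤? n
  ... | yes E≤n = trans (toSeries-sub-≤ g n E E≤n)
                        (trans (g≡h (n ℕ.∸ E) (ℕP.∸-monoʳ-< E≥1 E≤n)) (sym (toSeries-sub-≤ h n E E≤n)))
  ... | no E≰n = trans (toSeries-sub-> g n E (ℕP.≰⇒> E≰n)) (sym (toSeries-sub-> h n E (ℕP.≰⇒> E≰n)))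

  sign : ℕ → ℤ
  sign j = -1ℤ ^ j

  sign-suc : ∀ j → sign (suc j) ≡ - sign j
  sign-suc j = ℤP.-1*i≡-i (sign j)

  sign-+ : ∀ a b → sign (a ℕ.+ b) ≡ sign a * sign b
  sign-+ a b = ℤP.^-distribˡ-+-* -1ℤ a b

  sign-double : ∀ t → sign (t ℕ.+ t) ≡ 1ℤ
  sign-double zero = refl
  sign-double (suc t) =
    trans (cong sign (ℕP.+-suc (suc t) t)) (trans (lem (sign (t ℕ.+ t))) (sign-double t))
    where
    lem : ∀ x → -1ℤ * (-1ℤ * x) ≡ x
    lem = solve-∀

  sign-odd : ∀ t → sign (suc (t ℕ.+ t)) ≡ -1ℤ
  sign-odd t = trans (cong (-1ℤ *_) (sign-double t)) (ℤP.*-identityʳ -1ℤ)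

  sign-sq : ∀ j → sign j * sign j ≡ 1ℤ
  sign-sq j = trans (sym (sign-+ j j)) (sign-double j)


module GaussianBinomial (w : ℕ) where
  open import Data.Nat as ℕ using (ℕ; zero; suc; _∸_)
  open import Data.Integer
    using (ℤ; +_; 0ℤ; 1ℤ; _+_; _*_; -_; _-_; _≤_; +≤+)
  import Data.Integer.Properties as ℤP
  import Data.Nat.Properties as ℕP
  open import Data.Integer.Tactic.RingSolver using (solve-∀)
  open import Data.List using (List; []; _∷_)
  open import Data.Sum using (inj₁; inj₂)
  open import Relation.Nullary using (yes; no)
  open import Relation.Binary.PropositionalEquality
  open Series

  W : ℤ
  W = + w

  -- ΔAP c K f = ∏_{i<K} (1 - q^(c + i w)) f
  ΔAP : ℤ → ℕ → Series → Series
  ΔAP c zero f = f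
  ΔAP c (suc K) f = Δ c (ΔAP (c + W) K f)

  -- [K choose j] in the variable q^w, defined by the q-Pascal rule
  gauss : ℕ → ℕ → Series
  gauss zero zero = 𝟙
  gauss zero (suc j) = 𝟘
  gauss (suc K) zero = 𝟙
  gauss (suc K) (suc j) = gauss K j ⊕ shift (+ (w ℕ.* suc j)) (gauss K (suc j))

  gauss-0 : ∀ K → gauss K 0 ≈ 𝟙
  gauss-0 zero = ≈-refl
  gauss-0 (suc K) = ≈-refl

  gauss-above : ∀ K j → K ℕ.< j → gauss K j ≈ 𝟘
  gauss-above zero (suc j) p = ≈-refl
  gauss-above (suc K) (suc j) (ℕ.s≤s p) =
    ⊕-cong (gauss-above K j p) (shift-cong _ (gauss-above K (suc j) (ℕP.m≤n⇒m≤1+n p)))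

  gauss-isPowerSeries : ∀ K j → IsPowerSeries (gauss K j)
  gauss-isPowerSeries zero zero = 𝟙-isPowerSeries
  gauss-isPowerSeries zero (suc j) = λ z _ → refl
  gauss-isPowerSeries (suc K) zero = 𝟙-isPowerSeries
  gauss-isPowerSeries (suc K) (suc j) =
    ⊕-isPowerSeries (gauss-isPowerSeries K j)
                    (shift-isPowerSeries _ (+≤+ ℕ.z≤n) (gauss-isPowerSeries K (suc j)))

  triangle : ℕ → ℤ
  triangle zero = 0ℤ
  triangle (suc j) = + j + triangle j

  -- the exponent j c + w j (j - 1) / 2 of the j-th term of the q-binomial theorem
  qbinExp : ℤ → ℕ → ℤ
  qbinExp c j = + j * c + W * triangle j

  qbinExp-0 : ∀ c → qbinExp c 0 ≡ 0ℤ
  qbinExp-0 c = lem c W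
    where
    lem : ∀ c W → 0ℤ * c + W * 0ℤ ≡ 0ℤ
    lem = solve-∀

  qbinExp-suc : ∀ z c j → z - qbinExp c (suc j) ≡ z - c - qbinExp (c + W) j
  qbinExp-suc z c j = lem z c (+ j) W (triangle j)
    where
    lem : ∀ z c J W T → z - ((1ℤ + J) * c + W * (J + T)) ≡ z - c - (J * (c + W) + W * T)
    lem = solve-∀

  qbinExp-suc-shift : ∀ z c j →
                      z - qbinExp c (suc j) - + (w ℕ.* suc j) ≡ z - qbinExp (c + W) (suc j)
  qbinExp-suc-shift z c j =
    trans (cong (λ t → z - qbinExp c (suc j) - t) (ℤP.pos-* w (suc j))) (lem z c (+ j) W (triangle j))
    where
    lem : ∀ z c J W T → z - ((1ℤ + J) * c + W * (J + T)) - W * (1ℤ + J)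
                        ≡ z - ((1ℤ + J) * (c + W) + W * (J + T))
    lem = solve-∀

  qbinTerm : ℤ → ℕ → ℕ → Series
  qbinTerm c K j = sign j ⊙ shift (qbinExp c j) (gauss K j)

  qbinTerm-0 : ∀ c K → qbinTerm c K 0 ≈ 𝟙
  qbinTerm-0 c K z =
    trans (cong (λ t → 1ℤ * gauss K 0 (z - t)) (qbinExp-0 c))
          (trans (ℤP.*-identityˡ _) (trans (gauss-0 K _) (cong 𝟙 (ℤP.+-identityʳ z))))

  qbinTerm-above : ∀ c K → qbinTerm c K (suc K) ≈ 𝟘
  qbinTerm-above c K z =
    trans (cong (sign (suc K) *_) (gauss-above K (suc K) (ℕP.n<1+n K) _)) (ℤP.*-zeroʳ (sign (suc K)))

  qbinTerm-pascal : ∀ c K j →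
    ⊖ shift c (qbinTerm (c + W) K j) ⊕ qbinTerm (c + W) K (suc j) ≈ qbinTerm c (suc K) (suc j)
  qbinTerm-pascal c K j z = sym (trans (ℤP.*-distribˡ-+ (sign (suc j)) _ _) (cong₂ _+_ left right))
    where
    left : sign (suc j) * gauss K j (z - qbinExp c (suc j))
           ≡ - (sign j * gauss K j (z - c - qbinExp (c + W) j))
    left = trans (cong₂ _*_ (sign-suc j) (cong (gauss K j) (qbinExp-suc z c j)))
                 (sym (ℤP.neg-distribˡ-* (sign j) _))
    right : sign (suc j) * gauss K (suc j) (z - qbinExp c (suc j) - + (w ℕ.* suc j))
            ≡ sign (suc j) * gauss K (suc j) (z - qbinExp (c + W) (suc j))
    right = cong (λ t → sign (suc j) * gauss K (suc j) t) (qbinExp-suc-shift z c j)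

  q-binomial : ∀ K c → ΔAP c K 𝟙 ≈ sumₛ (suc K) (qbinTerm c K)
  q-binomial zero c z = sym (trans (ℤP.+-identityˡ _) (qbinTerm-0 c 0 z))
  q-binomial (suc K) c = begin
      Δ c (ΔAP (c + W) K 𝟙)
    ≈⟨ Δ-cong c (q-binomial K (c + W)) ⟩
      Δ c (sumₛ (suc K) X)
    ≈⟨ Δ-sumₛ-split c K X (qbinTerm-above (c + W) K) ⟩
      X 0 ⊕ sumₛ (suc K) (λ j → ⊖ shift c (X j) ⊕ X (suc j))
    ≈⟨ ⊕-cong (≈-trans (qbinTerm-0 (c + W) K) (≈-sym (qbinTerm-0 c (suc K))))
              (sumₛ-cong (suc K) (qbinTerm-pascal c K)) ⟩
      qbinTerm c (suc K) 0 ⊕ sumₛ (suc K) (λ j → qbinTerm c (suc K) (suc j))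
    ≈⟨ ≈-sym (sumₛ-suc (suc K) (qbinTerm c (suc K))) ⟩
      sumₛ (suc (suc K)) (qbinTerm c (suc K))
    ∎
    where
    open ≈-Reasoning
    X = qbinTerm (c + W) K

  multiples : ℕ → List ℕ
  multiples zero = []
  multiples (suc m) = w ℕ.* suc m ∷ multiples m

  private
    split-bound : ∀ K j → j ℕ.< K →
                  + (w ℕ.* suc (K ∸ j)) ≤ + (w ℕ.* suc (K ∸ suc j)) + + (w ℕ.* suc j)
    split-bound K j j<K = subst (+ (w ℕ.* suc (K ∸ j)) ≤_) (ℤP.pos-+ (w ℕ.* suc r) (w ℕ.* suc j)) (+≤+ (begin
        w ℕ.* suc (K ∸ j)               ≡⟨ cong (λ t → w ℕ.* suc t) (ℕP.+-∸-assoc 1 j<K) ⟩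
        w ℕ.* suc (suc r)               ≤⟨ ℕP.*-monoʳ-≤ w (ℕ.s≤s (ℕP.≤-trans (ℕ.s≤s (ℕP.m≤m+n r j))
                                                                     (ℕP.≤-reflexive (sym (ℕP.+-suc r j))))) ⟩
        w ℕ.* (suc r ℕ.+ suc j)         ≡⟨ ℕP.*-distribˡ-+ w (suc r) (suc j) ⟩
        w ℕ.* suc r ℕ.+ w ℕ.* suc j     ∎))
      where
      open ℕP.≤-Reasoning
      r = K ∸ suc j

  -- (q^w;q^w)_j [K choose j] = (q^w;q^w)_K / (q^w;q^w)_(K-j) is 1 modulo q^(w (K-j+1))
  Δ∏-multiples-gauss : ∀ K j → j ℕ.≤ K → Δ∏ (multiples j) (gauss K j) ≈[< + (w ℕ.* suc (K ∸ j)) ] 𝟙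
  Δ∏-multiples-gauss K zero _ = ≈⇒≈[<] (gauss-0 K)
  Δ∏-multiples-gauss (suc K) (suc j) (ℕ.s≤s j≤K) =
    ≈[<]-trans (≈⇒≈[<] split) (≈[<]-trans (≈[<]-⊕ low high) (≈⇒≈[<] (Δ⊕shift e 𝟙)))
    where
    e = + (w ℕ.* suc j)
    u = + (w ℕ.* suc (K ∸ j))
    A = Δ∏ (multiples j) (gauss K j)
    B = Δ∏ (multiples j) (gauss K (suc j))
    split : Δ∏ (multiples (suc j)) (gauss (suc K) (suc j)) ≈ Δ e A ⊕ shift e (Δ e B)
    split = ≈-trans (Δ-cong e (Δ∏-⊕ (multiples j) _ _))
              (≈-trans (Δ-⊕ e A _)
                (⊕-cong (≈-refl {Δ e A}) (≈-trans (Δ-cong e (Δ∏-shift (multiples j) e _)) (Δ-shift e e B))))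
    low : Δ e A ≈[< u ] Δ e 𝟙
    low = ≈[<]-Δ e (+≤+ ℕ.z≤n) (Δ∏-multiples-gauss K j j≤K)
    high : shift e (Δ e B) ≈[< u ] shift e 𝟙
    high with j ℕ.<? K
    ... | yes j<K = ≈[<]-mono (split-bound K j j<K) (≈[<]-shift e (Δ∏-multiples-gauss K (suc j) j<K))
    ... | no j≮K =
      ≈[<]-trans (≈⇒≈[<] B-vanishes) (≈[<]-mono u≤e (≈[<]-sym (shift≈[<]𝟘 e 𝟙 𝟙-isPowerSeries)))
      where
      K≤j = ℕP.≮⇒≥ j≮K
      B-vanishes : shift e (Δ e B) ≈ 𝟘
      B-vanishes z = trans (Δ-cong e (≈-trans (Δ∏-cong (multiples j) (gauss-above K (suc j) (ℕ.s≤s K≤j)))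
                                              (Δ∏-𝟘 (multiples j))) (z - e))
                           (ℤP.+-identityʳ 0ℤ)
      u≤e : u ≤ e
      u≤e = +≤+ (ℕP.*-monoʳ-≤ w (ℕ.s≤s (ℕP.≤-trans (ℕP.m∸n≤m K j) K≤j)))

  Δ∏-multiples-stable : ∀ d j Y U → IsPowerSeries Y → U ≤ + (w ℕ.* suc j) →
                        Δ∏ (multiples (d ℕ.+ j)) Y ≈[< U ] Δ∏ (multiples j) Y
  Δ∏-multiples-stable zero j Y U _ _ = ≈⇒≈[<] ≈-refl
  Δ∏-multiples-stable (suc d) j Y U Y⁺ U≤ =
    ≈[<]-trans (≈[<]-mono U≤c (Δ≈[<]id c _ (Δ∏-isPowerSeries (multiples (d ℕ.+ j)) Y⁺)))
               (Δ∏-multiples-stable d j Y U Y⁺ U≤)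
    where
    c = + (w ℕ.* suc (d ℕ.+ j))
    U≤c : U ≤ c
    U≤c = ℤP.≤-trans U≤ (+≤+ (ℕP.*-monoʳ-≤ w (ℕ.s≤s (ℕP.m≤n+m j d))))

  Δ∏-multiples-gauss-truncated : ∀ N K j → j ℕ.≤ K → ∀ U →
    U ≤ + (w ℕ.* suc (K ∸ j)) → U ≤ + (w ℕ.* suc j) → U ≤ + (w ℕ.* suc N) →
    Δ∏ (multiples N) (gauss K j) ≈[< U ] 𝟙
  Δ∏-multiples-gauss-truncated N K j j≤K U U≤K-j U≤j U≤N with ℕP.≤-total j N
  ... | inj₁ j≤N = subst (λ m → Δ∏ (multiples m) (gauss K j) ≈[< U ] 𝟙) (ℕP.m∸n+n≡m j≤N)
      (≈[<]-trans (Δ∏-multiples-stable (N ∸ j) j _ U (gauss-isPowerSeries K j) U≤j) gauss≈𝟙)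
    where
    gauss≈𝟙 = ≈[<]-mono U≤K-j (Δ∏-multiples-gauss K j j≤K)
  ... | inj₂ N≤j = ≈[<]-trans
      (≈[<]-sym (subst (λ m → Δ∏ (multiples m) (gauss K j) ≈[< U ] Δ∏ (multiples N) (gauss K j))
                       (ℕP.m∸n+n≡m N≤j) (Δ∏-multiples-stable (j ∸ N) N _ U (gauss-isPowerSeries K j) U≤N)))
      (≈[<]-mono U≤K-j (Δ∏-multiples-gauss K j j≤K))


module JacobiTriple (w-2 : ℕ) where
  open import Data.Nat as ℕ using (zero; suc; _∸_)
  open import Data.Integer using (ℤ; +_; 1ℤ; -1ℤ; _+_; _*_; -_; _-_; _≤_; +≤+)
  import Data.Integer.Properties as ℤP
  import Data.Nat.Properties as ℕP
  open import Data.Integer.Tactic.RingSolver using (solve-∀)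
  import Data.Nat.Tactic.RingSolver as ℕSolver
  open import Data.List using (List; []; _∷_)
  open import Data.Product using (Σ; _×_; _,_)
  open import Data.Sum using (inj₁; inj₂)
  open import Relation.Binary.PropositionalEquality
  open Series

  w′ w : ℕ
  w′ = suc w-2
  w = suc w′

  open GaussianBinomial w public

  progression : ℕ → ℕ → List ℕ
  progression x zero = []
  progression x (suc A) = x ∷ progression (x ℕ.+ w) A

  plusOnes : ℕ → List ℕ
  plusOnes zero = []
  plusOnes (suc B) = suc (w ℕ.* B) ∷ plusOnes B

  -- the elements of S_(w+2) = {x ≥ 1 | x ≡ 0, ±1 (mod w)} up to w N + 1, in decreasing order
  sParts : ℕ → List ℕ
  sParts zero = 1 ∷ []
  sParts (suc N) = suc (w ℕ.* suc N) ∷ w ℕ.* suc N ∷ (w′ ℕ.+ w ℕ.* N) ∷ sParts N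

  -- gonal∓ m = m (w m ∓ (w - 2)) / 2, the generalized (w+2)-gonal numbers
  gonal⁻ : ℕ → ℕ
  gonal⁻ zero = 0
  gonal⁻ (suc B) = gonal⁻ B ℕ.+ suc (w ℕ.* B)

  gonal⁺ : ℕ → ℕ
  gonal⁺ zero = 0
  gonal⁺ (suc m) = gonal⁺ m ℕ.+ (w′ ℕ.+ w ℕ.* m)

  gonal⁻-≥ : ∀ i → i ℕ.≤ gonal⁻ i
  gonal⁻-≥ zero = ℕ.z≤n
  gonal⁻-≥ (suc i) = subst (ℕ._≤ gonal⁻ i ℕ.+ suc (w ℕ.* i)) (ℕP.+-comm i 1)
                           (ℕP.+-mono-≤ (gonal⁻-≥ i) (ℕ.s≤s ℕ.z≤n))

  gonal⁺-≥ : ∀ m → m ℕ.≤ gonal⁺ m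
  gonal⁺-≥ zero = ℕ.z≤n
  gonal⁺-≥ (suc m) = subst (ℕ._≤ gonal⁺ m ℕ.+ (w′ ℕ.+ w ℕ.* m)) (ℕP.+-comm m 1)
                           (ℕP.+-mono-≤ (gonal⁺-≥ m) (ℕ.s≤s ℕ.z≤n))

  gonal⁺-closed : ∀ m → 2 ℕ.* gonal⁺ m ≡ m ℕ.* (w ℕ.* m ℕ.+ w-2)
  gonal⁺-closed zero = refl
  gonal⁺-closed (suc m) =
    trans (ℕP.*-distribˡ-+ 2 (gonal⁺ m) _)
          (trans (cong (ℕ._+ 2 ℕ.* (w′ ℕ.+ w ℕ.* m)) (gonal⁺-closed m)) (lem m w-2))
    where
    lem : ∀ m d → m ℕ.* ((2 ℕ.+ d) ℕ.* m ℕ.+ d) ℕ.+ 2 ℕ.* ((1 ℕ.+ d) ℕ.+ (2 ℕ.+ d) ℕ.* m)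
                  ≡ (1 ℕ.+ m) ℕ.* ((2 ℕ.+ d) ℕ.* (1 ℕ.+ m) ℕ.+ d)
    lem = ℕSolver.solve-∀

  gonal⁻-closed : ∀ m → 2 ℕ.* gonal⁻ m ≡ m ℕ.* (w ℕ.* m ∸ w-2)
  gonal⁻-closed m = sym (begin
      m ℕ.* (w ℕ.* m ∸ w-2)                          ≡⟨ ℕP.*-distribˡ-∸ m (w ℕ.* m) w-2 ⟩
      m ℕ.* (w ℕ.* m) ∸ m ℕ.* w-2                    ≡⟨ cong (ℕ._∸ m ℕ.* w-2) (sym (added m)) ⟩
      2 ℕ.* gonal⁻ m ℕ.+ m ℕ.* w-2 ∸ m ℕ.* w-2        ≡⟨ ℕP.m+n∸n≡m (2 ℕ.* gonal⁻ m) (m ℕ.* w-2) ⟩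
      2 ℕ.* gonal⁻ m                                 ∎)
    where
    open ≡-Reasoning
    added : ∀ m → 2 ℕ.* gonal⁻ m ℕ.+ m ℕ.* w-2 ≡ m ℕ.* (w ℕ.* m)
    added zero = refl
    added (suc m) =
      trans (lem (gonal⁻ m) m w-2)
            (trans (cong (ℕ._+ (2 ℕ.+ w-2 ℕ.+ 2 ℕ.* (w ℕ.* m))) (added m)) (lem′ m w-2))
      where
      lem : ∀ g m d → 2 ℕ.* (g ℕ.+ (1 ℕ.+ (2 ℕ.+ d) ℕ.* m)) ℕ.+ (1 ℕ.+ m) ℕ.* d
                      ≡ (2 ℕ.* g ℕ.+ m ℕ.* d) ℕ.+ (2 ℕ.+ d ℕ.+ 2 ℕ.* ((2 ℕ.+ d) ℕ.* m))
      lem = ℕSolver.solve-∀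
      lem′ : ∀ m d → m ℕ.* ((2 ℕ.+ d) ℕ.* m) ℕ.+ (2 ℕ.+ d ℕ.+ 2 ℕ.* ((2 ℕ.+ d) ℕ.* m))
                     ≡ (1 ℕ.+ m) ℕ.* ((2 ℕ.+ d) ℕ.* (1 ℕ.+ m))
      lem′ = ℕSolver.solve-∀

  ΔAP-progression : ∀ A x f → ΔAP (+ x) A f ≈ Δ∏ (progression x A) f
  ΔAP-progression zero x f = ≈-refl
  ΔAP-progression (suc A) x f =
    Δ-cong (+ x) (λ z → trans (cong (λ t → ΔAP t A f z) (sym (ℤP.pos-+ x w)))
                              (ΔAP-progression A (x ℕ.+ w) f z))

  startExp : ℕ → ℤ
  startExp B = + w′ - + (w ℕ.* B)

  private
    pos-w*suc : ∀ B → + (w ℕ.* suc B) ≡ W + + (w ℕ.* B)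
    pos-w*suc B = trans (cong +_ (ℕP.*-suc w B)) (ℤP.pos-+ w (w ℕ.* B))

  startExp-suc : ∀ B → startExp (suc B) + W ≡ startExp B
  startExp-suc B = trans (cong (λ t → + w′ - t + W) (pos-w*suc B)) (lem (+ w′) W (+ (w ℕ.* B)))
    where
    lem : ∀ a W x → a - (W + x) + W ≡ a - x
    lem = solve-∀

  startExp-suc-neg : ∀ B → startExp (suc B) ≡ - + suc (w ℕ.* B)
  startExp-suc-neg B =
    trans (cong (λ t → + w′ - t) (trans (pos-w*suc B) (cong (_+ + (w ℕ.* B)) (ℤP.pos-+ 1 w′))))
          (lem (+ w′) (+ (w ℕ.* B)))
    where
    lem : ∀ a x → a - ((1ℤ + a) + x) ≡ - (1ℤ + x)
    lem = solve-∀

  startExp-0 : startExp 0 ≡ + w′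
  startExp-0 = trans (cong (λ t → + w′ - + t) (ℕP.*-zeroʳ w)) (ℤP.+-identityʳ (+ w′))

  -- The first B factors 1 - q^(w′ - w b), b = B … 1, have negative exponents; turning each
  -- into - q^(-(1 + w (b-1))) (1 - q^(1 + w (b-1))) produces the factors ≡ 1 (mod w).
  ΔAP-startExp : ∀ B A f →
    ΔAP (startExp B) (B ℕ.+ A) f ≈ sign B ⊙ shift (- + gonal⁻ B) (Δ∏ (plusOnes B) (ΔAP (+ w′) A f))
  ΔAP-startExp zero A f z =
    trans (cong (λ t → ΔAP t A f z) startExp-0)
          (sym (trans (ℤP.*-identityˡ _) (cong (ΔAP (+ w′) A f) (ℤP.+-identityʳ z))))
  ΔAP-startExp (suc B) A f z =
    trans (cong (λ t → Δ (startExp (suc B)) (ΔAP t (B ℕ.+ A) f) z) (startExp-suc B))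
    (trans (Δ-cong (startExp (suc B)) (ΔAP-startExp B A f) z)
    (trans (cong (λ t → Δ t X z) (startExp-suc-neg B))
    (trans (Δ-neg v X z)
    (trans (cong -_ (trans (Δ-⊙ v (sign B) (shift s Y) (z - - v))
                           (cong (sign B *_) (Δ-shift v s Y (z - - v)))))
    (trans (ℤP.neg-distribˡ-* (sign B) _)
           (cong₂ _*_ (sym (sign-suc B)) (cong (Δ v Y) (exponent z))))))))
    where
    v = + suc (w ℕ.* B)
    s = - + gonal⁻ B
    Y = Δ∏ (plusOnes B) (ΔAP (+ w′) A f)
    X = sign B ⊙ shift s Y
    exponent : ∀ z → z - - v - s ≡ z - - + gonal⁻ (suc B)
    exponent z = trans (lem z v (+ gonal⁻ B))
                       (cong (λ t → z - - t) (sym (ℤP.pos-+ (gonal⁻ B) (suc (w ℕ.* B)))))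
      where
      lem : ∀ z v σ → z - - v - - σ ≡ z - - (σ + v)
      lem = solve-∀

  Δ∏-plusOnes-progression : ∀ B A f →
    Δ∏ (plusOnes B) (Δ∏ (progression w′ A) f) ≈ sign B ⊙ shift (+ gonal⁻ B) (ΔAP (startExp B) (B ℕ.+ A) f)
  Δ∏-plusOnes-progression B A f z = sym (
    trans (cong (sign B *_) (ΔAP-startExp B A f (z - + gonal⁻ B)))
    (trans (sym (ℤP.*-assoc (sign B) (sign B) _))
    (trans (cong₂ _*_ (sign-sq B) (cong (Δ∏ (plusOnes B) (ΔAP (+ w′) A f)) (lem z (+ gonal⁻ B))))
    (trans (ℤP.*-identityˡ _) (Δ∏-cong (plusOnes B) (ΔAP-progression A w′ f) z)))))
    where
    lem : ∀ z s → z - s - - s ≡ z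
    lem = solve-∀

  Δ∏-progression-snoc : ∀ A x f →
    Δ∏ (progression x (suc A)) f ≈ Δ (+ (x ℕ.+ w ℕ.* A)) (Δ∏ (progression x A) f)
  Δ∏-progression-snoc zero x f =
    Δ-congˡ f (cong +_ (sym (trans (cong (x ℕ.+_) (ℕP.*-zeroʳ w)) (ℕP.+-identityʳ x))))
  Δ∏-progression-snoc (suc A) x f = begin
      Δ (+ x) (Δ∏ (progression (x ℕ.+ w) (suc A)) f)
    ≈⟨ Δ-cong (+ x) (Δ∏-progression-snoc A (x ℕ.+ w) f) ⟩
      Δ (+ x) (Δ (+ (x ℕ.+ w ℕ.+ w ℕ.* A)) Z)
    ≈⟨ Δ-comm (+ x) (+ (x ℕ.+ w ℕ.+ w ℕ.* A)) Z ⟩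
      Δ (+ (x ℕ.+ w ℕ.+ w ℕ.* A)) (Δ (+ x) Z)
    ≈⟨ Δ-congˡ (Δ (+ x) Z) (cong +_ (lem x w A)) ⟩
      Δ (+ (x ℕ.+ w ℕ.* suc A)) (Δ (+ x) Z)
    ∎
    where
    open ≈-Reasoning
    Z = Δ∏ (progression (x ℕ.+ w) A) f
    lem : ∀ x w A → x ℕ.+ w ℕ.+ w ℕ.* A ≡ x ℕ.+ w ℕ.* suc A
    lem = ℕSolver.solve-∀

  Δ∏-sParts : ∀ N f →
    Δ∏ (sParts N) f ≈ Δ∏ (multiples N) (Δ∏ (plusOnes (suc N)) (Δ∏ (progression w′ N) f))
  Δ∏-sParts zero f = Δ-congˡ f (cong (λ t → + suc t) (sym (ℕP.*-zeroʳ w)))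
  Δ∏-sParts (suc N) f = begin
      Δ x₁ (Δ x₀ (Δ x₋₁ (Δ∏ (sParts N) f)))
    ≈⟨ Δ-cong x₁ (Δ-cong x₀ (Δ-cong x₋₁ (Δ∏-sParts N f))) ⟩
      Δ x₁ (Δ x₀ (Δ x₋₁ (Δ∏ (multiples N) V)))
    ≈⟨ Δ-comm x₁ x₀ (Δ x₋₁ (Δ∏ (multiples N) V)) ⟩
      Δ x₀ (Δ x₁ (Δ x₋₁ (Δ∏ (multiples N) V)))
    ≈⟨ Δ-cong x₀ (Δ-cong x₁ (≈-sym (Δ∏-Δ (multiples N) x₋₁ V))) ⟩
      Δ x₀ (Δ x₁ (Δ∏ (multiples N) (Δ x₋₁ V)))
    ≈⟨ Δ-cong x₀ (≈-sym (Δ∏-Δ (multiples N) x₁ (Δ x₋₁ V))) ⟩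
      Δ x₀ (Δ∏ (multiples N) (Δ x₁ (Δ x₋₁ V)))
    ≈⟨ Δ-cong x₀ (Δ∏-cong (multiples N) (Δ-cong x₁ (≈-sym (Δ∏-Δ (plusOnes (suc N)) x₋₁ _)))) ⟩
      Δ x₀ (Δ∏ (multiples N) (Δ x₁ (Δ∏ (plusOnes (suc N)) (Δ x₋₁ (Δ∏ (progression w′ N) f)))))
    ≈⟨ Δ-cong x₀ (Δ∏-cong (multiples N) (Δ-cong x₁ (Δ∏-cong (plusOnes (suc N))
                                                     (≈-sym (Δ∏-progression-snoc N w′ f))))) ⟩
      Δ x₀ (Δ∏ (multiples N) (Δ x₁ (Δ∏ (plusOnes (suc N)) (Δ∏ (progression w′ (suc N)) f))))
    ∎
    where
    open ≈-Reasoning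
    x₁ = + suc (w ℕ.* suc N)
    x₀ = + (w ℕ.* suc N)
    x₋₁ = + (w′ ℕ.+ w ℕ.* N)
    V = Δ∏ (plusOnes (suc N)) (Δ∏ (progression w′ N) f)

  jtpExp : ℕ → ℕ → ℤ
  jtpExp B j = + gonal⁻ B + qbinExp (startExp B) j

  jtpExp-suc : ∀ B j → jtpExp (suc B) (suc j) ≡ jtpExp B j
  jtpExp-suc B j = trans lhs (trans (lem s x jj t a) (sym rhs))
    where
    s = + gonal⁻ B
    x = + (w ℕ.* B)
    jj = + j
    t = triangle j
    a = + w′
    lhs : jtpExp (suc B) (suc j) ≡ (s + (1ℤ + x)) + ((1ℤ + jj) * (- (1ℤ + x)) + (1ℤ + a) * (jj + t))
    lhs = cong₂ _+_ (ℤP.pos-+ (gonal⁻ B) (suc (w ℕ.* B)))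
                    (cong (λ e → + suc j * e + W * (jj + t)) (startExp-suc-neg B))
    rhs : jtpExp B j ≡ s + (jj * (a - x) + (1ℤ + a) * t)
    rhs = refl
    lem : ∀ s x jj t a → (s + (1ℤ + x)) + ((1ℤ + jj) * (- (1ℤ + x)) + (1ℤ + a) * (jj + t))
                        ≡ s + (jj * (a - x) + (1ℤ + a) * t)
    lem = solve-∀

  jtpExp-below : ∀ i j → jtpExp (j ℕ.+ i) j ≡ + gonal⁻ i
  jtpExp-below i zero =
    trans (cong (λ q → + gonal⁻ i + q) (qbinExp-0 (startExp i))) (ℤP.+-identityʳ (+ gonal⁻ i))
  jtpExp-below i (suc j) = trans (jtpExp-suc (j ℕ.+ i) j) (jtpExp-below i j)

  qbinExp-gonal⁺ : ∀ m → qbinExp (+ w′) m ≡ + gonal⁺ m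
  qbinExp-gonal⁺ zero = qbinExp-0 (+ w′)
  qbinExp-gonal⁺ (suc m) =
    trans (lem (+ m) (+ w′) W (triangle m))
    (trans (cong₂ _+_ (qbinExp-gonal⁺ m) (cong (λ q → + w′ + q) (sym (ℤP.pos-* w m))))
    (trans (cong (λ q → + gonal⁺ m + q) (sym (ℤP.pos-+ w′ (w ℕ.* m))))
           (sym (ℤP.pos-+ (gonal⁺ m) (w′ ℕ.+ w ℕ.* m)))))
    where
    lem : ∀ M a W t → (1ℤ + M) * a + W * (M + t) ≡ (M * a + W * t) + (a + W * M)
    lem = solve-∀

  jtpExp-above : ∀ B m → jtpExp B (B ℕ.+ m) ≡ + gonal⁺ m
  jtpExp-above zero m =
    trans (ℤP.+-identityˡ _) (trans (cong (λ t → qbinExp t m) startExp-0) (qbinExp-gonal⁺ m))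
  jtpExp-above (suc B) m = trans (jtpExp-suc B (B ℕ.+ m)) (jtpExp-above B m)

  -- the truncated theta series  f ∑_{|m| ≤ N} (-1)^m q^(m (w m - (w-2)) / 2)
  theta : ℕ → Series → Series
  theta N f = f ⊕ sumₛ N (λ i → sign (suc i) ⊙ (shift (+ gonal⁺ (suc i)) f ⊕ shift (+ gonal⁻ (suc i)) f))

  theta-cong : ∀ N {f g} → f ≈ g → theta N f ≈ theta N g
  theta-cong N e z = cong₂ _+_ (e z) (sumℤ-cong N (λ i → cong (sign (suc i) *_) (cong₂ _+_ (e _) (e _))))

  Δ∏-theta : ∀ N xs f → Δ∏ xs (theta N f) ≈ theta N (Δ∏ xs f)
  Δ∏-theta N xs f =
    ≈-trans (Δ∏-⊕ xs f _)
            (⊕-cong (≈-refl {Δ∏ xs f}) (≈-trans (Δ∏-sumₛ xs N _) (sumₛ-cong N term)))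
    where
    term : ∀ i → Δ∏ xs (sign (suc i) ⊙ (shift (+ gonal⁺ (suc i)) f ⊕ shift (+ gonal⁻ (suc i)) f))
                 ≈ sign (suc i) ⊙ (shift (+ gonal⁺ (suc i)) (Δ∏ xs f) ⊕ shift (+ gonal⁻ (suc i)) (Δ∏ xs f))
    term i = ≈-trans (Δ∏-⊙ xs (sign (suc i)) _)
               (⊙-cong (sign (suc i)) (≈-trans (Δ∏-⊕ xs _ _) (⊕-cong (Δ∏-shift xs _ f) (Δ∏-shift xs _ f))))

  theta-isPowerSeries : ∀ N {f} → IsPowerSeries f → IsPowerSeries (theta N f)
  theta-isPowerSeries N f⁺ =
    ⊕-isPowerSeries f⁺ (sumₛ-isPowerSeries N (λ i → ⊙-isPowerSeries (sign (suc i))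
      (⊕-isPowerSeries (shift-isPowerSeries _ (+≤+ ℕ.z≤n) f⁺) (shift-isPowerSeries _ (+≤+ ℕ.z≤n) f⁺))))

  jtpTerm : ℕ → ℕ → Series
  jtpTerm B j = (sign B * sign j) ⊙ shift (jtpExp B j) 𝟙

  jtpTerm-suc : ∀ B j → jtpTerm (suc B) (suc j) ≈ jtpTerm B j
  jtpTerm-suc B j z = cong₂ (λ p q → p * 𝟙 (z - q)) (lem (sign B) (sign j)) (jtpExp-suc B j)
    where
    lem : ∀ x y → (-1ℤ * x) * (-1ℤ * y) ≡ x * y
    lem = solve-∀

  jtpTerm-0-0 : jtpTerm 0 0 ≈ 𝟙
  jtpTerm-0-0 z = trans (cong (λ t → 1ℤ * 𝟙 (z - t)) (jtpExp-above 0 0))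
                        (trans (ℤP.*-identityˡ _) (cong 𝟙 (ℤP.+-identityʳ z)))

  jtpTerm-0-suc : ∀ m → jtpTerm 0 (suc m) ≈ sign (suc m) ⊙ shift (+ gonal⁺ (suc m)) 𝟙
  jtpTerm-0-suc m z = cong₂ (λ p q → p * 𝟙 (z - q)) (ℤP.*-identityˡ (sign (suc m))) (jtpExp-above 0 (suc m))

  jtpTerm-suc-0 : ∀ i → jtpTerm (suc i) 0 ≈ sign (suc i) ⊙ shift (+ gonal⁻ (suc i)) 𝟙
  jtpTerm-suc-0 i z = cong₂ (λ p q → p * 𝟙 (z - q)) (ℤP.*-identityʳ (sign (suc i))) (jtpExp-below (suc i) 0)

  sumₛ-jtpTerm : ∀ N → sumₛ (suc (suc N ℕ.+ N)) (jtpTerm (suc N)) ≈ theta N 𝟙 ⊕ jtpTerm (suc N) 0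
  sumₛ-jtpTerm N = begin
      sumₛ (suc (suc N ℕ.+ N)) (jtpTerm (suc N))
    ≈⟨ (λ z → cong (λ t → sumₛ (suc t) (jtpTerm (suc N)) z) (sym (ℕP.+-suc N N))) ⟩
      sumₛ (suc N ℕ.+ suc N) (jtpTerm (suc N))
    ≈⟨ sumₛ-reindex jtpTerm jtpTerm-suc (suc N) N ⟩
      sumₛ (suc N) (jtpTerm 0) ⊕ (sumₛ N (λ i → jtpTerm (suc i) 0) ⊕ jtpTerm (suc N) 0)
    ≈⟨ ⊕-cong (sumₛ-suc N (jtpTerm 0)) (≈-refl {sumₛ N (λ i → jtpTerm (suc i) 0) ⊕ jtpTerm (suc N) 0}) ⟩
      (jtpTerm 0 0 ⊕ sumₛ N (λ m → jtpTerm 0 (suc m)))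
        ⊕ (sumₛ N (λ i → jtpTerm (suc i) 0) ⊕ jtpTerm (suc N) 0)
    ≈⟨ (λ z → lem (jtpTerm 0 0 z) (sumₛ N (λ m → jtpTerm 0 (suc m)) z)
                  (sumₛ N (λ i → jtpTerm (suc i) 0) z) (jtpTerm (suc N) 0 z)) ⟩
      jtpTerm 0 0 ⊕ (sumₛ N (λ m → jtpTerm 0 (suc m)) ⊕ sumₛ N (λ i → jtpTerm (suc i) 0)) ⊕ jtpTerm (suc N) 0
    ≈⟨ ⊕-cong (⊕-cong jtpTerm-0-0 (≈-trans (≈-sym (sumₛ-⊕ N _ _)) (sumₛ-cong N pair)))
              (≈-refl {jtpTerm (suc N) 0}) ⟩
      theta N 𝟙 ⊕ jtpTerm (suc N) 0
    ∎
    where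
    open ≈-Reasoning
    lem : ∀ a s₁ s₂ h → a + s₁ + (s₂ + h) ≡ a + (s₁ + s₂) + h
    lem = solve-∀
    pair : ∀ i → jtpTerm 0 (suc i) ⊕ jtpTerm (suc i) 0
                 ≈ sign (suc i) ⊙ (shift (+ gonal⁺ (suc i)) 𝟙 ⊕ shift (+ gonal⁻ (suc i)) 𝟙)
    pair i z = trans (cong₂ _+_ (jtpTerm-0-suc i z) (jtpTerm-suc-0 i z))
                     (sym (ℤP.*-distribˡ-+ (sign (suc i)) _ _))

  jtpTerm-last≈[<]𝟘 : ∀ N → jtpTerm (suc N) 0 ≈[< + suc N ] 𝟘
  jtpTerm-last≈[<]𝟘 N z p =
    trans (cong (sign (suc N) * 1ℤ *_) (shift≈[<]𝟘 _ 𝟙 𝟙-isPowerSeries z (ℤP.<-≤-trans p N<e)))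
          (ℤP.*-zeroʳ (sign (suc N) * 1ℤ))
    where
    N<e : + suc N ≤ jtpExp (suc N) 0
    N<e = subst (+ suc N ≤_) (sym (jtpExp-below (suc N) 0)) (+≤+ (gonal⁻-≥ (suc N)))

  ExponentBounds : ℕ → ℕ → Set
  ExponentBounds N j = Σ ℕ λ v →
    jtpExp (suc N) j ≡ + v × N ℕ.≤ v ℕ.+ (suc N ℕ.+ N ∸ j) × N ℕ.≤ v ℕ.+ j

  exponentBounds : ∀ N j → j ℕ.≤ suc N ℕ.+ N → ExponentBounds N j
  exponentBounds N j j≤K with ℕP.≤-total (suc N) j
  ... | inj₁ N<j =
    subst (ExponentBounds N) (ℕP.m+[n∸m]≡n N<j) (above (j ∸ suc N) (ℕP.m≤n+o⇒m∸n≤o j (suc N) j≤K))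
    where
    open ℕP.≤-Reasoning
    above : ∀ m → m ℕ.≤ N → ExponentBounds N (suc N ℕ.+ m)
    above m m≤N = gonal⁺ m , jtpExp-above (suc N) m , b₁ , b₂
      where
      b₁ = begin
        N                                        ≡⟨ ℕP.m+[n∸m]≡n m≤N ⟨
        m ℕ.+ (N ∸ m)                             ≤⟨ ℕP.+-monoˡ-≤ (N ∸ m) (gonal⁺-≥ m) ⟩
        gonal⁺ m ℕ.+ (N ∸ m)                      ≡⟨ cong (gonal⁺ m ℕ.+_) (ℕP.[m+n]∸[m+o]≡n∸o (suc N) N m) ⟨
        gonal⁺ m ℕ.+ (suc N ℕ.+ N ∸ (suc N ℕ.+ m)) ∎
      b₂ = ℕP.≤-trans (ℕP.n≤1+n N) (ℕP.≤-trans (ℕP.m≤m+n (suc N) m) (ℕP.m≤n+m _ (gonal⁺ m)))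
  ... | inj₂ j≤N+1 = below (suc N ∸ j) (ℕP.m+[n∸m]≡n j≤N+1)
    where
    open ℕP.≤-Reasoning
    below : ∀ i → j ℕ.+ i ≡ suc N → ExponentBounds N j
    below i eq = gonal⁻ i , trans (cong (λ t → jtpExp t j) (sym eq)) (jtpExp-below i j) , b₁ , b₂
      where
      b₁ = begin
        N                            ≡⟨ ℕP.m+n∸m≡n (suc N) N ⟨
        suc N ℕ.+ N ∸ suc N          ≤⟨ ℕP.∸-monoʳ-≤ (suc N ℕ.+ N) j≤N+1 ⟩
        suc N ℕ.+ N ∸ j              ≤⟨ ℕP.m≤n+m _ (gonal⁻ i) ⟩
        gonal⁻ i ℕ.+ (suc N ℕ.+ N ∸ j) ∎
      b₂ = begin
        N                  ≤⟨ ℕP.n≤1+n N ⟩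
        suc N              ≡⟨ eq ⟨
        j ℕ.+ i            ≤⟨ ℕP.+-monoʳ-≤ j (gonal⁻-≥ i) ⟩
        j ℕ.+ gonal⁻ i     ≡⟨ ℕP.+-comm j (gonal⁻ i) ⟩
        gonal⁻ i ℕ.+ j     ∎

  private
    ≤+⇒-≤w* : ∀ N v x → N ℕ.≤ v ℕ.+ x → + suc N - + v ≤ + (w ℕ.* suc x)
    ≤+⇒-≤w* N v x N≤ = subst (+ suc N - + v ≤_) (lem (+ v) (+ (w ℕ.* suc x)))
                             (ℤP.+-monoˡ-≤ (- + v) (subst (+ suc N ≤_) (ℤP.pos-+ v _) (+≤+ sN≤)))
      where
      lem : ∀ v c → v + c - v ≡ c
      lem = solve-∀
      sN≤ : suc N ℕ.≤ v ℕ.+ w ℕ.* suc x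
      sN≤ = ℕP.≤-trans (ℕ.s≤s N≤) (ℕP.≤-trans (ℕP.≤-reflexive (sym (ℕP.+-suc v x)))
                                              (ℕP.+-monoʳ-≤ v (ℕP.m≤n*m (suc x) w)))

  jtpTerm-truncated : ∀ N j → j ℕ.≤ suc N ℕ.+ N →
    (sign (suc N) * sign j) ⊙ shift (jtpExp (suc N) j) (Δ∏ (multiples N) (gauss (suc N ℕ.+ N) j))
    ≈[< + suc N ] jtpTerm (suc N) j
  jtpTerm-truncated N j j≤K with exponentBounds N j j≤K
  ... | v , e≡v , b₁ , b₂ = ≈[<]-⊙ (sign (suc N) * sign j) (≈[<]-mono U+e (≈[<]-shift e stable))
    where
    e = jtpExp (suc N) j
    U = + suc N - e
    U+e : + suc N ≤ U + e
    U+e = ℤP.≤-reflexive (sym (lem (+ suc N) e))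
      where
      lem : ∀ a b → a - b + b ≡ a
      lem = solve-∀
    bound : ∀ x → N ℕ.≤ v ℕ.+ x → U ≤ + (w ℕ.* suc x)
    bound x N≤ = subst (λ t → + suc N - t ≤ + (w ℕ.* suc x)) (sym e≡v) (≤+⇒-≤w* N v x N≤)
    stable = Δ∏-multiples-gauss-truncated N (suc N ℕ.+ N) j j≤K U
               (bound _ b₁) (bound j b₂) (bound N (ℕP.m≤n+m N v))

  Δ∏-sParts-expansion : ∀ N →
    Δ∏ (sParts N) 𝟙 ≈ sumₛ (suc (suc N ℕ.+ N)) (λ j → (sign (suc N) * sign j) ⊙
                        shift (jtpExp (suc N) j) (Δ∏ (multiples N) (gauss (suc N ℕ.+ N) j)))
  Δ∏-sParts-expansion N = begin
      Δ∏ (sParts N) 𝟙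
    ≈⟨ Δ∏-sParts N 𝟙 ⟩
      Δ∏ (multiples N) (Δ∏ (plusOnes B) (Δ∏ (progression w′ N) 𝟙))
    ≈⟨ Δ∏-cong (multiples N) (Δ∏-plusOnes-progression B N 𝟙) ⟩
      Δ∏ (multiples N) (sign B ⊙ shift (+ gonal⁻ B) (ΔAP (startExp B) K 𝟙))
    ≈⟨ Δ∏-cong (multiples N) (⊙-cong (sign B) (shift-cong _ (q-binomial K (startExp B)))) ⟩
      Δ∏ (multiples N) (sign B ⊙ shift (+ gonal⁻ B) (sumₛ (suc K) (qbinTerm (startExp B) K)))
    ≈⟨ Δ∏-⊙-shift-sumₛ (multiples N) (sign B) (+ gonal⁻ B) (suc K) (qbinExp (startExp B)) sign (gauss K) ⟩
      sumₛ (suc K) (λ j → (sign B * sign j) ⊙ shift (jtpExp B j) (Δ∏ (multiples N) (gauss K j)))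
    ∎
    where
    open ≈-Reasoning
    B = suc N
    K = B ℕ.+ N

  Δ∏-sParts≈[<]theta : ∀ N → Δ∏ (sParts N) 𝟙 ≈[< + suc N ] theta N 𝟙
  Δ∏-sParts≈[<]theta N =
    ≈[<]-trans (≈⇒≈[<] (Δ∏-sParts-expansion N))
    (≈[<]-trans (≈[<]-sumₛ (suc K) (λ j j<K+1 → jtpTerm-truncated N j (ℕP.≤-pred j<K+1)))
    (≈[<]-trans (≈⇒≈[<] (sumₛ-jtpTerm N))
    (≈[<]-trans (≈[<]-⊕ (≈⇒≈[<] (≈-refl {theta N 𝟙})) (jtpTerm-last≈[<]𝟘 N))
                (≈⇒≈[<] (⊕-identityʳ (theta N 𝟙))))))
    where
    K = suc N ℕ.+ N


module PartLists where
  open import Data.Nat using (zero; suc)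
  open import Data.List using (List; []; _∷_; map)
  open import Data.List.Membership.Propositional using (_∈_)
  import Data.List.Membership.Propositional.Properties as ∈P
  open import Data.List.Relation.Unary.Any using (here)
  open import Data.List.Relation.Unary.Unique.Propositional using (Unique)
  import Data.List.Relation.Unary.Unique.Propositional.Properties as UniqueP
  open import Data.List.Relation.Unary.All using ([])
  open import Data.List.Relation.Unary.AllPairs using ([]; _∷_)
  open import Data.Product using (Σ; _×_; _,_)
  open import Data.Empty using (⊥-elim)
  open import Relation.Nullary using (Dec; yes; no; ¬_)
  open import Relation.Binary.PropositionalEquality

  noParts : ℕ → List (List ℕ)
  noParts zero = [] ∷ []
  noParts (suc _) = []

  ∈-noParts⁻ : ∀ {n xs} → xs ∈ noParts n → xs ≡ [] × n ≡ 0
  ∈-noParts⁻ {zero} (here refl) = refl , refl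

  noParts-unique : ∀ n → Unique (noParts n)
  noParts-unique zero = [] ∷ []
  noParts-unique (suc n) = []

  prepend? : {P : Set} → Dec P → ℕ → List (List ℕ) → List (List ℕ)
  prepend? (yes _) p xss = map (p ∷_) xss
  prepend? (no _) p xss = []

  prepend?-yes : ∀ {P : Set} (d : Dec P) p xss → P → prepend? d p xss ≡ map (p ∷_) xss
  prepend?-yes (yes _) p xss _ = refl
  prepend?-yes (no ¬P) p xss P = ⊥-elim (¬P P)

  prepend?-no : ∀ {P : Set} (d : Dec P) p xss → ¬ P → prepend? d p xss ≡ []
  prepend?-no (yes P) p xss ¬P = ⊥-elim (¬P P)
  prepend?-no (no _) p xss _ = refl

  ∈-prepend?⁻ : ∀ {P : Set} (d : Dec P) p xss {v} → v ∈ prepend? d p xss →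
                P × Σ (List ℕ) λ ys → v ≡ p ∷ ys × ys ∈ xss
  ∈-prepend?⁻ (yes P) p xss v∈ with ∈P.∈-map⁻ (p ∷_) v∈
  ... | ys , ys∈ , refl = P , ys , refl , ys∈

  ∈-prepend?⁺ : ∀ {P : Set} (d : Dec P) p {xss ys} → P → ys ∈ xss → p ∷ ys ∈ prepend? d p xss
  ∈-prepend?⁺ (yes _) p _ ys∈ = ∈P.∈-map⁺ (p ∷_) ys∈
  ∈-prepend?⁺ (no ¬P) p P _ = ⊥-elim (¬P P)

  prepend?-unique : ∀ {P : Set} (d : Dec P) p {xss} → Unique xss → Unique (prepend? d p xss)
  prepend?-unique (yes _) p u = UniqueP.map⁺ ∷-injectiveʳ u
    where
    ∷-injectiveʳ : ∀ {xs ys : List ℕ} → p ∷ xs ≡ p ∷ ys → xs ≡ ys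
    ∷-injectiveʳ refl = refl
  prepend?-unique (no _) p u = []


module Partitions where
  open import Data.Nat using (zero; suc; _+_; _∸_; _≤_; _<_; _≥_; _>_; _≤?_)
  import Data.Nat.Properties as ℕP
  open import Data.Nat.ListAction using (sum)
  open import Data.List as List using (List; []; _∷_; _++_; length)
  import Data.List.Properties as ListP
  open import Data.List.Relation.Unary.All as All using (All; []; _∷_)
  open import Data.List.Relation.Unary.Any using (here; there)
  open import Data.List.Relation.Unary.Linked using (Linked; []; [-]; _∷_)
  import Data.List.Relation.Unary.Linked.Properties as LinkedP
  open import Data.List.Relation.Unary.Unique.Propositional using (Unique)
  import Data.List.Relation.Unary.Unique.Propositional.Properties as UniqueP
  open import Data.List.Membership.Propositional using (_∈_)
  import Data.List.Membership.Propositional.Properties as ∈P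
  open import Data.Product using (_×_; _,_)
  open import Data.Sum using (inj₁; inj₂)
  open import Data.Empty using (⊥-elim)
  open import Relation.Nullary using (¬_)
  open import Relation.Binary.PropositionalEquality
  open import Defs using (IsPartition)
  open PartLists

  Descending : List ℕ → Set
  Descending = Linked _>_

  -- correct for fuel f ≥ n; the fuel only makes the recursion structural
  partitions : ℕ → List ℕ → ℕ → List (List ℕ)
  partitions f [] n = noParts n
  partitions zero (p ∷ ps) n = noParts n
  partitions (suc f) (p ∷ ps) n =
    prepend? (p ≤? n) p (partitions f (p ∷ ps) (n ∸ p)) ++ partitions (suc f) ps n

  private
    descending-tail : ∀ {p ps} → Descending (p ∷ ps) → Descending ps
    descending-tail [-] = []
    descending-tail (_ ∷ d) = d

    descending-head : ∀ {p ps} → Descending (p ∷ ps) → All (p >_) ps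
    descending-head {ps = []} _ = []
    descending-head {ps = q ∷ ps} (p>q ∷ d) = LinkedP.Linked⇒All (λ i>j j>k → ℕP.<-trans j>k i>j) p>q d

    nonincreasing-head : ∀ {x ys} → Linked _≥_ (x ∷ ys) → All (x ≥_) ys
    nonincreasing-head {ys = []} _ = []
    nonincreasing-head {ys = y ∷ ys} (x≥y ∷ l) =
      LinkedP.Linked⇒All (λ i≥j j≥k → ℕP.≤-trans j≥k i≥j) x≥y l

    linked-tail : ∀ {x ys} → Linked _≥_ (x ∷ ys) → Linked _≥_ ys
    linked-tail [-] = []
    linked-tail (_ ∷ l) = l

    part≤sum : ∀ x ys → x ≤ sum (x ∷ ys)
    part≤sum x ys = ℕP.m≤m+n x (sum ys)

  partitions-zero-fuel : ∀ ps n → partitions zero ps n ≡ noParts n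
  partitions-zero-fuel [] n = refl
  partitions-zero-fuel (p ∷ ps) n = refl

  partitions-of-0 : ∀ f ps → All (1 ≤_) ps → partitions f ps 0 ≡ noParts 0
  partitions-of-0 f [] _ = refl
  partitions-of-0 zero (p ∷ ps) _ = refl
  partitions-of-0 (suc f) (p ∷ ps) (p≥1 ∷ ps≥1) =
    trans (cong (_++ partitions (suc f) ps 0) (prepend?-no (p ≤? 0) p _ (ℕP.<⇒≱ p≥1)))
          (partitions-of-0 (suc f) ps ps≥1)

  partitions-fuel : ∀ f f′ ps n → All (1 ≤_) ps → n ≤ f → n ≤ f′ →
                    partitions f ps n ≡ partitions f′ ps n
  partitions-fuel f f′ [] n _ _ _ = refl
  partitions-fuel zero f′ (p ∷ ps) zero ps≥1 _ _ = sym (partitions-of-0 f′ (p ∷ ps) ps≥1)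
  partitions-fuel (suc f) zero (p ∷ ps) zero ps≥1 _ _ = partitions-of-0 (suc f) (p ∷ ps) ps≥1
  partitions-fuel (suc f) (suc f′) (p ∷ ps) n (p≥1 ∷ ps≥1) n≤f n≤f′ =
    cong₂ (λ xss yss → prepend? (p ≤? n) p xss ++ yss)
          (partitions-fuel f f′ (p ∷ ps) (n ∸ p) (p≥1 ∷ ps≥1) (remaining n≤f) (remaining n≤f′))
          (partitions-fuel (suc f) (suc f′) ps n ps≥1 n≤f n≤f′)
    where
    remaining : ∀ {g} → n ≤ suc g → n ∸ p ≤ g
    remaining n≤g = ℕP.≤-trans (ℕP.∸-monoʳ-≤ n p≥1) (ℕP.∸-monoˡ-≤ 1 n≤g)

  partitions-skip : ∀ f p ps n → n < p → partitions f (p ∷ ps) n ≡ partitions f ps n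
  partitions-skip zero p ps n n<p = sym (partitions-zero-fuel ps n)
  partitions-skip (suc f) p ps n n<p =
    cong (_++ partitions (suc f) ps n) (prepend?-no (p ≤? n) p _ (ℕP.<⇒≱ n<p))

  length-partitions : ∀ f p ps n → p ≤ n → length (partitions (suc f) (p ∷ ps) n)
                      ≡ length (partitions f (p ∷ ps) (n ∸ p)) + length (partitions (suc f) ps n)
  length-partitions f p ps n p≤n =
    trans (ListP.length-++ (prepend? (p ≤? n) p _))
          (cong (_+ length (partitions (suc f) ps n))
                (trans (cong length (prepend?-yes (p ≤? n) p _ p≤n))
                       (ListP.length-map (List._∷_ p) (partitions f (p ∷ ps) (n ∸ p)))))

  private
    prepend-nonincreasing : ∀ {p ps ys} → Descending (p ∷ ps) → Linked _≥_ ys → All (_∈ p ∷ ps) ys →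
                            Linked _≥_ (p ∷ ys)
    prepend-nonincreasing {ys = []} d l a = [-]
    prepend-nonincreasing {p} {ps} {y ∷ ys} d l (y∈ ∷ _) = p≥ y∈ ∷ l
      where
      p≥ : ∀ {y} → y ∈ p ∷ ps → p ≥ y
      p≥ (here refl) = ℕP.≤-refl
      p≥ (there y∈) = ℕP.<⇒≤ (All.lookup (descending-head d) y∈)

  partitions-sound : ∀ f ps n xs → Descending ps → xs ∈ partitions f ps n → IsPartition (_∈ ps) n xs
  partitions-sound f [] n xs _ m with ∈-noParts⁻ {n} m
  ... | refl , refl = [] , [] , refl
  partitions-sound zero (p ∷ ps) n xs _ m with ∈-noParts⁻ {n} m
  ... | refl , refl = [] , [] , refl
  partitions-sound (suc f) (p ∷ ps) n xs d m with ∈P.∈-++⁻ (prepend? (p ≤? n) p _) m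
  ... | inj₂ m′ with partitions-sound (suc f) ps n xs (descending-tail d) m′
  ...   | l , a , s = l , All.map there a , s
  partitions-sound (suc f) (p ∷ ps) n xs d m | inj₁ m′ with ∈-prepend?⁻ (p ≤? n) p _ m′
  ... | p≤n , ys , refl , ys∈ with partitions-sound f (p ∷ ps) (n ∸ p) ys d ys∈
  ...   | l , a , s = prepend-nonincreasing d l a , here refl ∷ a , trans (cong (p +_) s) (ℕP.m+[n∸m]≡n p≤n)

  partitions-complete : ∀ f ps n xs → Descending ps → All (1 ≤_) ps → n ≤ f →
                        IsPartition (_∈ ps) n xs → xs ∈ partitions f ps n
  partitions-complete f ps n [] _ ps≥1 _ (_ , _ , refl) =
    subst ([] ∈_) (sym (partitions-of-0 f ps ps≥1)) (here refl)
  partitions-complete f [] n (x ∷ ys) _ _ _ (_ , () ∷ _ , _)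
  partitions-complete zero (p ∷ ps) n (x ∷ ys) _ ps≥1 n≤0 (_ , x∈ ∷ _ , s) =
    ⊥-elim (1≰0 (ℕP.≤-trans (All.lookup ps≥1 x∈)
                            (ℕP.≤-trans (part≤sum x ys) (ℕP.≤-trans (ℕP.≤-reflexive s) n≤0))))
    where
    1≰0 : ¬ (1 ≤ 0)
    1≰0 ()
  partitions-complete (suc f) (p ∷ ps) n (p ∷ ys) d ps≥1@(p≥1 ∷ _) n≤f (l , here refl ∷ a , s) =
    ∈P.∈-++⁺ˡ (∈-prepend?⁺ (p ≤? n) p p≤n
      (partitions-complete f (p ∷ ps) (n ∸ p) ys d ps≥1 remaining (linked-tail l , a , sum-ys)))
    where
    p≤n : p ≤ n
    p≤n = ℕP.≤-trans (part≤sum p ys) (ℕP.≤-reflexive s)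
    sum-ys : sum ys ≡ n ∸ p
    sum-ys = trans (sym (ℕP.m+n∸m≡n p (sum ys))) (cong (_∸ p) s)
    remaining : n ∸ p ≤ f
    remaining = ℕP.≤-trans (ℕP.∸-monoʳ-≤ n p≥1) (ℕP.∸-monoˡ-≤ 1 n≤f)
  partitions-complete (suc f) (p ∷ ps) n (x ∷ ys) d (_ ∷ ps≥1) n≤f (l , there x∈ ∷ a , s) =
    ∈P.∈-++⁺ʳ (prepend? (p ≤? n) p _)
      (partitions-complete (suc f) ps n (x ∷ ys) (descending-tail d) ps≥1 n≤f (l , x∈ ∷ ys∈ps , s))
    where
    x<p : x < p
    x<p = All.lookup (descending-head d) x∈
    below-p : ∀ {y} → x ≥ y × y ∈ p ∷ ps → y ∈ ps
    below-p (_ , there y∈) = y∈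
    below-p (y≤x , here refl) = ⊥-elim (ℕP.<-irrefl refl (ℕP.≤-<-trans y≤x x<p))
    ys∈ps : All (_∈ ps) ys
    ys∈ps = All.zipWith below-p (nonincreasing-head l , a)

  partitions-unique : ∀ f ps n → Descending ps → Unique (partitions f ps n)
  partitions-unique f [] n _ = noParts-unique n
  partitions-unique zero (p ∷ ps) n _ = noParts-unique n
  partitions-unique (suc f) (p ∷ ps) n d =
    UniqueP.++⁺ (prepend?-unique (p ≤? n) p (partitions-unique f (p ∷ ps) (n ∸ p) d))
                (partitions-unique (suc f) ps n (descending-tail d)) disjoint
    where
    disjoint : ∀ {v} → ¬ (v ∈ prepend? (p ≤? n) p _ × v ∈ partitions (suc f) ps n)
    disjoint (v∈A , v∈B) with ∈-prepend?⁻ (p ≤? n) p _ v∈A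
    ... | _ , ys , refl , _ with partitions-sound (suc f) ps n (p ∷ ys) (descending-tail d) v∈B
    ...   | _ , p∈ ∷ _ , _ = ℕP.<-irrefl refl (All.lookup (descending-head d) p∈)


module PartitionSeries where
  open import Data.Nat as ℕ using (zero; suc; _∸_; _≤?_)
  import Data.Nat.Properties as ℕP
  open import Data.Integer using (ℤ; +_; -[1+_]; _+_; _-_)
  import Data.Integer.Properties as ℤP
  open import Data.Integer.Tactic.RingSolver using (solve-∀)
  open import Data.List using (List; []; _∷_; length)
  open import Data.List.Relation.Unary.All using (All; []; _∷_)
  open import Relation.Nullary using (yes; no)
  open import Relation.Binary.PropositionalEquality
  open import Data.Empty using (⊥-elim)
  open Series
  open Partitions

  partitionCount : List ℕ → ℕ → ℤ
  partitionCount ps m = + length (partitions m ps m)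

  partitionSeries : List ℕ → Series
  partitionSeries ps = toSeries (partitionCount ps)

  partitionCount-∷ : ∀ p ps m → 1 ℕ.≤ p → All (1 ℕ.≤_) ps → p ℕ.≤ m →
                     partitionCount (p ∷ ps) m ≡ partitionCount (p ∷ ps) (m ∸ p) + partitionCount ps m
  partitionCount-∷ p ps zero p≥1 ps≥1 p≤0 = ⊥-elim (ℕP.<⇒≱ p≥1 p≤0)
  partitionCount-∷ p ps (suc m) p≥1 ps≥1 p≤m =
    trans (cong +_ (trans (length-partitions m p ps (suc m) p≤m)
                          (cong (λ xss → length xss ℕ.+ length (partitions (suc m) ps (suc m)))
                                (partitions-fuel m (suc m ∸ p) (p ∷ ps) (suc m ∸ p) (p≥1 ∷ ps≥1)
                                                 (ℕP.∸-monoʳ-≤ (suc m) p≥1) ℕP.≤-refl))))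
          (ℤP.pos-+ (length (partitions (suc m ∸ p) (p ∷ ps) (suc m ∸ p))) (length (partitions (suc m) ps (suc m))))

  Δ-partitionSeries : ∀ p ps → 1 ℕ.≤ p → All (1 ℕ.≤_) ps →
                      Δ (+ p) (partitionSeries (p ∷ ps)) ≈ partitionSeries ps
  Δ-partitionSeries (suc p) ps _ _ -[1+ k ] = refl
  Δ-partitionSeries p ps p≥1 ps≥1 (+ m) with p ≤? m
  ... | yes p≤m = trans (cong₂ _-_ (partitionCount-∷ p ps m p≥1 ps≥1 p≤m)
                                   (toSeries-sub-≤ (partitionCount (p ∷ ps)) m p p≤m))
                        (lem (partitionCount (p ∷ ps) (m ∸ p)) (partitionCount ps m))
    where
    lem : ∀ a b → a + b - a ≡ b
    lem = solve-∀
  ... | no p≰m = trans (cong₂ _-_ (cong (λ xss → + length xss) (partitions-skip m p ps m (ℕP.≰⇒> p≰m)))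
                                  (toSeries-sub-> (partitionCount (p ∷ ps)) m p (ℕP.≰⇒> p≰m)))
                       (ℤP.+-identityʳ _)

  Δ∏-partitionSeries : ∀ ps → All (1 ℕ.≤_) ps → Δ∏ ps (partitionSeries ps) ≈ 𝟙
  Δ∏-partitionSeries [] _ (+ zero) = refl
  Δ∏-partitionSeries [] _ (+ suc m) = refl
  Δ∏-partitionSeries [] _ -[1+ m ] = refl
  Δ∏-partitionSeries (p ∷ ps) (p≥1 ∷ ps≥1) =
    ≈-trans (≈-sym (Δ∏-Δ ps (+ p) (partitionSeries (p ∷ ps))))
            (≈-trans (Δ∏-cong ps (Δ-partitionSeries p ps p≥1 ps≥1)) (Δ∏-partitionSeries ps ps≥1))


open import Data.Nat using (_≤_)
open import Data.List using (List)
open import Data.List.Relation.Unary.All using (All)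
open import Data.List.Relation.Unary.Unique.Propositional using (Unique)
open import Data.List.Membership.Propositional using (_∈_)

module Compositions
  (A : ℕ → Set) (candidates : ℕ → List ℕ)
  (candidates-positive : ∀ n → All (1 ≤_) (candidates n))
  (candidates-unique : ∀ n → Unique (candidates n))
  (candidates-sound : ∀ n x → x ∈ candidates n → A x)
  (candidates-complete : ∀ n x → A x → x ≤ n → x ∈ candidates n)
  (A-positive : ∀ x → A x → 1 ≤ x)
  where
  open import Data.Nat using (zero; suc; _+_; _∸_; _<_; z≤n; s≤s; _≤?_)
  import Data.Nat.Properties as ℕP
  open import Data.Nat.ListAction using (sum)
  open import Data.List using ([]; _∷_; _++_; map; length)
  open import Data.List.Relation.Unary.All as All using ([]; _∷_)
  open import Data.List.Relation.Unary.Any using (here; there)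
  open import Data.List.Relation.Unary.AllPairs using ([]; _∷_)
  import Data.List.Relation.Unary.Unique.Propositional.Properties as UniqueP
  import Data.List.Membership.Propositional.Properties as ∈P
  open import Data.Product using (Σ; _×_; _,_)
  open import Data.Sum using (inj₁; inj₂)
  open import Relation.Nullary using (yes; no; ¬_)
  open import Relation.Binary.PropositionalEquality
  open import Data.Integer using (ℤ; 0ℤ; -1ℤ; -_; _^_) renaming (_+_ to _+ℤ_; _*_ to _*ℤ_)
  open import Data.Integer.Tactic.RingSolver using (solve-∀)
  import Data.Integer.Properties as ℤP
  open import Defs using (IsComposition; signedCount)
  open PartLists

  extend : (ℕ → List (List ℕ)) → ℕ → List ℕ → List (List ℕ)
  extend rec n [] = []
  extend rec n (p ∷ ps) = prepend? (p ≤? n) p (rec (n ∸ p)) ++ extend rec n ps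

  -- correct for fuel f ≥ n; the fuel only makes the recursion structural
  compositions : ℕ → ℕ → List (List ℕ)
  compositions zero n = noParts n
  compositions (suc f) zero = [] ∷ []
  compositions (suc f) (suc n) = extend (compositions f) (suc n) (candidates (suc n))

  extend-cong : ∀ rec rec′ n ps → All (1 ≤_) ps → (∀ x → x < n → rec x ≡ rec′ x) →
                extend rec n ps ≡ extend rec′ n ps
  extend-cong rec rec′ n [] _ e = refl
  extend-cong rec rec′ n (p ∷ ps) (p≥1 ∷ ps≥1) e =
    cong₂ _++_ (first (p ≤? n)) (extend-cong rec rec′ n ps ps≥1 e)
    where
    first : ∀ d → prepend? d p (rec (n ∸ p)) ≡ prepend? d p (rec′ (n ∸ p))
    first (yes p≤n) = cong (map (p ∷_)) (e (n ∸ p) (ℕP.∸-monoʳ-< p≥1 p≤n))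
    first (no _) = refl

  compositions-fuel : ∀ f f′ n → n ≤ f → n ≤ f′ → compositions f n ≡ compositions f′ n
  compositions-fuel zero zero n _ _ = refl
  compositions-fuel zero (suc f′) zero _ _ = refl
  compositions-fuel (suc f) zero zero _ _ = refl
  compositions-fuel (suc f) (suc f′) zero _ _ = refl
  compositions-fuel (suc f) (suc f′) (suc n) (s≤s n≤f) (s≤s n≤f′) =
    extend-cong (compositions f) (compositions f′) (suc n) (candidates (suc n)) (candidates-positive (suc n))
      (λ x x<n → compositions-fuel f f′ x (ℕP.≤-trans (ℕP.≤-pred x<n) n≤f)
                                          (ℕP.≤-trans (ℕP.≤-pred x<n) n≤f′))

  extend-sound : ∀ rec n ps xs → (∀ x ys → x < n → ys ∈ rec x → IsComposition A x ys) →
                 (∀ x → x ∈ ps → A x) → xs ∈ extend rec n ps → IsComposition A n xs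
  extend-sound rec n (p ∷ ps) xs rec-sound ps-sound m with ∈P.∈-++⁻ (prepend? (p ≤? n) p (rec (n ∸ p))) m
  ... | inj₂ m′ = extend-sound rec n ps xs rec-sound (λ x x∈ → ps-sound x (there x∈)) m′
  ... | inj₁ m′ with ∈-prepend?⁻ (p ≤? n) p _ m′
  ...   | p≤n , ys , refl , ys∈
          with rec-sound (n ∸ p) ys (ℕP.∸-monoʳ-< (A-positive p (ps-sound p (here refl))) p≤n) ys∈
  ...     | a , s = ps-sound p (here refl) ∷ a , trans (cong (p +_) s) (ℕP.m+[n∸m]≡n p≤n)

  compositions-sound : ∀ f n xs → xs ∈ compositions f n → IsComposition A n xs
  compositions-sound zero n xs m with ∈-noParts⁻ {n} m
  ... | refl , refl = [] , refl
  compositions-sound (suc f) zero xs (here refl) = [] , refl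
  compositions-sound (suc f) (suc n) xs m =
    extend-sound (compositions f) (suc n) (candidates (suc n)) xs
      (λ x ys _ m′ → compositions-sound f x ys m′) (candidates-sound (suc n)) m

  extend-complete : ∀ rec n ps p ys → p ∈ ps → p ≤ n → ys ∈ rec (n ∸ p) → (p ∷ ys) ∈ extend rec n ps
  extend-complete rec n (q ∷ ps) p ys (here refl) p≤n m = ∈P.∈-++⁺ˡ (∈-prepend?⁺ (p ≤? n) p p≤n m)
  extend-complete rec n (q ∷ ps) p ys (there p∈) p≤n m =
    ∈P.∈-++⁺ʳ (prepend? (q ≤? n) q (rec (n ∸ q))) (extend-complete rec n ps p ys p∈ p≤n m)

  compositions-complete : ∀ f n xs → n ≤ f → IsComposition A n xs → xs ∈ compositions f n
  compositions-complete zero .0 [] _ ([] , refl) = here refl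
  compositions-complete (suc f) .0 [] _ ([] , refl) = here refl
  compositions-complete f n (x ∷ ys) n≤f (Ax ∷ a , s)
    with A-positive x Ax | ℕP.≤-trans (ℕP.m≤m+n x (sum ys)) (ℕP.≤-reflexive s)
  compositions-complete zero n (x ∷ ys) z≤n _ | () | z≤n
  compositions-complete (suc f) zero (x ∷ ys) _ _ | () | z≤n
  compositions-complete (suc f) (suc n) (x ∷ ys) (s≤s n≤f) (Ax ∷ a , s) | x≥1 | x≤n =
    extend-complete (compositions f) (suc n) (candidates (suc n)) x ys (candidates-complete (suc n) x Ax x≤n) x≤n
      (compositions-complete f (suc n ∸ x) ys remaining (a , sum-ys))
    where
    sum-ys : sum ys ≡ suc n ∸ x
    sum-ys = trans (sym (ℕP.m+n∸m≡n x (sum ys))) (cong (_∸ x) s)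
    remaining : suc n ∸ x ≤ f
    remaining = ℕP.≤-trans (ℕP.∸-monoʳ-≤ (suc n) x≥1) n≤f

  private
    extend-heads : ∀ rec n ps {v} → v ∈ extend rec n ps →
                   Σ ℕ λ q → Σ (List ℕ) λ ys → v ≡ q ∷ ys × q ∈ ps
    extend-heads rec n (p ∷ ps) m with ∈P.∈-++⁻ (prepend? (p ≤? n) p (rec (n ∸ p))) m
    ... | inj₁ m′ with ∈-prepend?⁻ (p ≤? n) p _ m′
    ...   | _ , ys , e , _ = p , ys , e , here refl
    extend-heads rec n (p ∷ ps) m | inj₂ m′ with extend-heads rec n ps m′
    ... | q , ys , e , q∈ = q , ys , e , there q∈

  extend-unique : ∀ rec n ps → Unique ps → (∀ x → Unique (rec x)) → Unique (extend rec n ps)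
  extend-unique rec n [] _ _ = []
  extend-unique rec n (p ∷ ps) (p∉ps ∷ ps-unique) rec-unique =
    UniqueP.++⁺ (prepend?-unique (p ≤? n) p (rec-unique (n ∸ p))) (extend-unique rec n ps ps-unique rec-unique)
                disjoint
    where
    disjoint : ∀ {v} → ¬ (v ∈ prepend? (p ≤? n) p (rec (n ∸ p)) × v ∈ extend rec n ps)
    disjoint (v∈A , v∈B) with ∈-prepend?⁻ (p ≤? n) p _ v∈A | extend-heads rec n ps v∈B
    ... | _ , ys , refl , _ | q , _ , refl , q∈ = All.lookup p∉ps q∈ refl

  compositions-unique : ∀ f n → Unique (compositions f n)
  compositions-unique zero n = noParts-unique n
  compositions-unique (suc f) zero = [] ∷ []
  compositions-unique (suc f) (suc n) =
    extend-unique (compositions f) (suc n) (candidates (suc n)) (candidates-unique (suc n)) (compositions-unique f)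

  signedCount-++ : ∀ xss yss → signedCount (xss ++ yss) ≡ signedCount xss +ℤ signedCount yss
  signedCount-++ [] yss = sym (ℤP.+-identityˡ (signedCount yss))
  signedCount-++ (xs ∷ xss) yss =
    trans (cong (λ t → (-1ℤ ^ length xs) +ℤ t) (signedCount-++ xss yss)) (sym (ℤP.+-assoc (-1ℤ ^ length xs) _ _))

  signedCount-map-∷ : ∀ p xss → signedCount (map (p ∷_) xss) ≡ - signedCount xss
  signedCount-map-∷ p [] = refl
  signedCount-map-∷ p (xs ∷ xss) =
    trans (cong (λ t → (-1ℤ ^ suc (length xs)) +ℤ t) (signedCount-map-∷ p xss))
          (lem (-1ℤ ^ length xs) (signedCount xss))
    where
    lem : ∀ a s → -1ℤ *ℤ a +ℤ - s ≡ - (a +ℤ s)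
    lem = solve-∀

  firstPartTerm : (ℕ → ℤ) → ℕ → ℕ → ℤ
  firstPartTerm c n p with p ≤? n
  ... | yes _ = - c (n ∸ p)
  ... | no _ = 0ℤ

  firstPartSum : (ℕ → ℤ) → ℕ → List ℕ → ℤ
  firstPartSum c n [] = 0ℤ
  firstPartSum c n (p ∷ ps) = firstPartTerm c n p +ℤ firstPartSum c n ps

  signedCount-extend : ∀ rec n ps → signedCount (extend rec n ps) ≡ firstPartSum (λ x → signedCount (rec x)) n ps
  signedCount-extend rec n [] = refl
  signedCount-extend rec n (p ∷ ps) =
    trans (signedCount-++ (prepend? (p ≤? n) p (rec (n ∸ p))) (extend rec n ps))
          (cong₂ _+ℤ_ first (signedCount-extend rec n ps))
    where
    first : signedCount (prepend? (p ≤? n) p (rec (n ∸ p))) ≡ firstPartTerm (λ x → signedCount (rec x)) n p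
    first with p ≤? n
    ... | yes _ = signedCount-map-∷ p (rec (n ∸ p))
    ... | no _ = refl


module EvenPolygonal (c : ℕ) where
  open import Data.Nat as ℕ using (zero; suc; _+_; _*_; _∸_; _<_; _>_; z≤n; s≤s; _≤?_; _≟_)
  import Data.Nat.Properties as ℕP
  open import Data.Nat.Divisibility using (_∣_; divides; _∣0; m∣m*n)
  open import Data.List using ([]; _∷_)
  open import Data.List.Relation.Unary.All using ([]; _∷_)
  open import Data.List.Relation.Unary.Any using (here; there)
  open import Data.List.Relation.Unary.Linked using ([]; [-]; _∷_)
  import Data.List.Relation.Unary.Linked.Properties as LinkedP
  import Data.List.Relation.Unary.AllPairs as AllPairs
  open import Data.Product using (Σ; _×_; _,_; proj₁; proj₂)
  open import Data.Sum using (_⊎_; inj₁; inj₂)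
  open import Relation.Nullary using (yes; no)
  open import Relation.Binary.PropositionalEquality
  import Data.Nat.Tactic.RingSolver as ℕSolver
  open import Data.Integer using (-1ℤ) renaming (_*_ to _*ℤ_)
  import Data.Integer.Properties as ℤP
  open import Defs using (S; P)
  open Partitions using (Descending)
  open Series using (sign; sign-+; sign-odd)

  open JacobiTriple (suc (suc (c + c))) public

  -- k = w + 2 = 2 c + 6, so that k ∸ 2 = w and k ∸ 4 = w-2 hold by computation
  k : ℕ
  k = suc (suc w)

  sParts-sound : ∀ N x → x ∈ sParts N → S k x
  sParts-sound zero x (here refl) = s≤s z≤n , inj₂ (inj₁ (w ∣0))
  sParts-sound (suc N) x (here refl) = s≤s z≤n , inj₂ (inj₁ (m∣m*n (suc N)))
  sParts-sound (suc N) x (there (here refl)) = s≤s z≤n , inj₁ (m∣m*n (suc N))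
  sParts-sound (suc N) x (there (there (here refl))) =
    s≤s z≤n , inj₂ (inj₂ (subst (w ∣_) (trans (ℕP.*-suc w N) (ℕP.+-comm 1 (w′ + w * N))) (m∣m*n (suc N))))
  sParts-sound (suc N) x (there (there (there x∈))) = sParts-sound N x x∈

  private
    multiple-between : ∀ y N → w ∣ y → w * N < y → y < w * suc (suc N) → y ≡ w * suc N
    multiple-between .(q * w) N (divides q refl) lo hi =
      trans (cong (_* w) (ℕP.≤-antisym (ℕP.≤-pred q<2+N) N<q)) (ℕP.*-comm (suc N) w)
      where
      N<q : N < q
      N<q = ℕP.*-cancelʳ-< w N q (subst (_< q * w) (ℕP.*-comm w N) lo)
      q<2+N : q < suc (suc N)
      q<2+N = ℕP.*-cancelʳ-< w q (suc (suc N)) (subst (q * w <_) (ℕP.*-comm w (suc (suc N))) hi)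

    below-next-multiple : ∀ N y → y ℕ.≤ suc (suc (w * N + w)) → y < w * suc (suc N)
    below-next-multiple N y y≤ =
      ℕP.≤-<-trans y≤ (subst (suc (suc (w * N + w)) <_) (sym (lem c N)) (ℕP.m<m+n _ (s≤s z≤n)))
      where
      lem : ∀ c N → suc (suc (suc (suc (c + c)))) * suc (suc N)
                    ≡ suc (suc (suc (suc (suc (suc (c + c)))) * N + suc (suc (suc (suc (c + c)))))) + suc (suc (c + c))
      lem = ℕSolver.solve-∀

  sParts-complete : ∀ N x → S k x → x ℕ.≤ suc (w * N) → x ∈ sParts N
  sParts-complete zero x (x≥1 , _) x≤ =
    subst (_∈ 1 ∷ []) (ℕP.≤-antisym x≥1 (subst (x ℕ.≤_) (cong suc (ℕP.*-zeroʳ w)) x≤)) (here refl)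
  sParts-complete (suc N) x (x≥1 , d) x≤ with x ≤? suc (w * N)
  ... | yes x≤′ = there (there (there (sParts-complete N x (x≥1 , d) x≤′)))
  ... | no x≰ = by-residue d
    where
    lo : suc (suc (w * N)) ℕ.≤ x
    lo = ℕP.≰⇒> x≰
    hi : x ℕ.≤ suc (w * N + w)
    hi = subst (λ t → x ℕ.≤ suc t) (trans (ℕP.*-suc w N) (ℕP.+-comm w (w * N))) x≤
    by-residue : w ∣ x ⊎ w ∣ x ∸ 1 ⊎ w ∣ x + 1 → x ∈ sParts (suc N)
    by-residue (inj₁ w∣x) =
      there (here (multiple-between x N w∣x (ℕP.≤-trans (ℕP.n≤1+n _) lo)
                                            (below-next-multiple N x (ℕP.≤-trans hi (ℕP.n≤1+n _)))))
    by-residue (inj₂ (inj₁ w∣x-1)) =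
      here (trans (sym (ℕP.m∸n+n≡m x≥1)) (trans (cong (_+ 1) x-1≡) (ℕP.+-comm _ 1)))
      where
      x-1≡ = multiple-between (x ∸ 1) N w∣x-1 (ℕP.∸-monoˡ-≤ 1 lo)
               (below-next-multiple N (x ∸ 1) (ℕP.≤-trans (ℕP.m∸n≤m x 1) (ℕP.≤-trans hi (ℕP.n≤1+n _))))
    by-residue (inj₂ (inj₂ w∣x+1)) = there (there (here (ℕP.+-cancelʳ-≡ 1 x (w′ + w * N) x+1≡)))
      where
      x+1≡ : x + 1 ≡ w′ + w * N + 1
      x+1≡ = trans (multiple-between (x + 1) N w∣x+1
                      (ℕP.≤-trans (ℕP.n≤1+n _) (ℕP.≤-trans lo (ℕP.m≤m+n x 1)))
                      (below-next-multiple N (x + 1) (subst (ℕ._≤ suc (suc (w * N + w))) (ℕP.+-comm 1 x) (s≤s hi))))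
                   (trans (ℕP.*-suc w N) (ℕP.+-comm 1 (w′ + w * N)))

  sParts-positive : ∀ N → All (1 ℕ.≤_) (sParts N)
  sParts-positive zero = s≤s z≤n ∷ []
  sParts-positive (suc N) = s≤s z≤n ∷ s≤s z≤n ∷ s≤s z≤n ∷ sParts-positive N

  sParts-descending : ∀ N → Descending (sParts N)
  sParts-descending zero = [-]
  sParts-descending (suc zero) = ℕP.n<1+n _ ∷ w*sN-1<w*sN 0 ∷ ℕP.m≤m+n 2 _ ∷ [-]
    where
    w*sN-1<w*sN : ∀ N → w′ + w * N < w * suc N
    w*sN-1<w*sN N = subst (w′ + w * N <_) (sym (ℕP.*-suc w N)) (ℕP.n<1+n _)
  sParts-descending (suc (suc N)) =
    ℕP.n<1+n _ ∷ w*sN-1<w*sN (suc N) ∷ ℕP.+-monoˡ-≤ (w * suc N) {2} {w′} (s≤s (s≤s z≤n))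
    ∷ sParts-descending (suc N)
    where
    w*sN-1<w*sN : ∀ N → w′ + w * N < w * suc N
    w*sN-1<w*sN N = subst (w′ + w * N <_) (sym (ℕP.*-suc w N)) (ℕP.n<1+n _)

  P-gonal : ∀ x → P k x → Σ ℕ λ m → 1 ℕ.≤ m × (x ≡ gonal⁺ m ⊎ x ≡ gonal⁻ m)
  P-gonal x (m , m≥1 , inj₁ e) =
    m , m≥1 , inj₁ (ℕP.*-cancelˡ-≡ x (gonal⁺ m) 2 (trans e (sym (gonal⁺-closed m))))
  P-gonal x (m , m≥1 , inj₂ e) =
    m , m≥1 , inj₂ (ℕP.*-cancelˡ-≡ x (gonal⁻ m) 2 (trans e (sym (gonal⁻-closed m))))

  P-positive : ∀ x → P k x → 1 ℕ.≤ x
  P-positive x Px with P-gonal x Px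
  ... | m , m≥1 , inj₁ refl = ℕP.≤-trans m≥1 (gonal⁺-≥ m)
  ... | m , m≥1 , inj₂ refl = ℕP.≤-trans m≥1 (gonal⁻-≥ m)

  gonals : ℕ → List ℕ
  gonals zero = []
  gonals (suc m) = gonal⁺ (suc m) ∷ gonal⁻ (suc m) ∷ gonals m

  gonals-positive : ∀ n → All (1 ℕ.≤_) (gonals n)
  gonals-positive zero = []
  gonals-positive (suc m) =
    ℕP.≤-trans (s≤s z≤n) (gonal⁺-≥ (suc m)) ∷ ℕP.≤-trans (s≤s z≤n) (gonal⁻-≥ (suc m)) ∷ gonals-positive m

  gonal⁻≤gonal⁺ : ∀ m → gonal⁻ m ℕ.≤ gonal⁺ m
  gonal⁻<gonal⁺ : ∀ m → gonal⁻ (suc m) < gonal⁺ (suc m)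
  gonal⁻≤gonal⁺ zero = z≤n
  gonal⁻≤gonal⁺ (suc m) = ℕP.<⇒≤ (gonal⁻<gonal⁺ m)
  gonal⁻<gonal⁺ m = ℕP.+-mono-≤-< (gonal⁻≤gonal⁺ m) (ℕP.+-monoˡ-≤ (w * m) {2} {w′} (s≤s (s≤s z≤n)))

  gonal⁺<gonal⁻ : ∀ m → gonal⁺ m < gonal⁻ (suc m)
  gonal⁺<gonal⁻ zero = s≤s z≤n
  gonal⁺<gonal⁻ (suc m) =
    ℕP.+-mono-<-≤ (gonal⁺<gonal⁻ m)
      (ℕP.≤-trans (ℕP.+-monoˡ-≤ (w * m) (ℕP.n≤1+n w′))
                  (ℕP.≤-trans (ℕP.≤-reflexive (sym (ℕP.*-suc w m))) (ℕP.n≤1+n _)))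

  gonals-descending : ∀ n → Descending (gonals n)
  gonals-descending zero = []
  gonals-descending (suc zero) = gonal⁻<gonal⁺ 0 ∷ [-]
  gonals-descending (suc (suc m)) = gonal⁻<gonal⁺ (suc m) ∷ gonal⁺<gonal⁻ (suc m) ∷ gonals-descending (suc m)

  gonals-unique : ∀ n → Unique (gonals n)
  gonals-unique n = AllPairs.map (λ x>y x≡y → ℕP.<-irrefl (sym x≡y) x>y)
                                 (LinkedP.Linked⇒AllPairs (λ i>j j>k → ℕP.<-trans j>k i>j) (gonals-descending n))

  gonals-sound : ∀ n x → x ∈ gonals n → P k x
  gonals-sound (suc m) x (here refl) = suc m , s≤s z≤n , inj₁ (gonal⁺-closed (suc m))
  gonals-sound (suc m) x (there (here refl)) = suc m , s≤s z≤n , inj₂ (gonal⁻-closed (suc m))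
  gonals-sound (suc m) x (there (there x∈)) = gonals-sound m x x∈

  ∈-gonals : ∀ n m → 1 ℕ.≤ m → m ℕ.≤ n → gonal⁺ m ∈ gonals n × gonal⁻ m ∈ gonals n
  ∈-gonals zero (suc m) _ ()
  ∈-gonals (suc n) m m≥1 m≤n with m ≟ suc n
  ... | yes refl = here refl , there (here refl)
  ... | no m≢ = there (there (proj₁ earlier)) , there (there (proj₂ earlier))
    where
    earlier = ∈-gonals n m m≥1 (ℕP.≤-pred (ℕP.≤∧≢⇒< m≤n m≢))

  gonals-complete : ∀ n x → P k x → x ℕ.≤ n → x ∈ gonals n
  gonals-complete n x Px x≤n with P-gonal x Px
  ... | m , m≥1 , inj₁ refl = proj₁ (∈-gonals n m m≥1 (ℕP.≤-trans (gonal⁺-≥ m) x≤n))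
  ... | m , m≥1 , inj₂ refl = proj₂ (∈-gonals n m m≥1 (ℕP.≤-trans (gonal⁻-≥ m) x≤n))

  -- w is even, so each step of gonal∓ is odd
  sign-gonal⁺ : ∀ m → sign (gonal⁺ m) ≡ sign m
  sign-gonal⁺ zero = refl
  sign-gonal⁺ (suc m) =
    trans (sign-+ (gonal⁺ m) (w′ + w * m))
          (trans (cong₂ _*ℤ_ (sign-gonal⁺ m) (trans (cong sign (lem m c)) (sign-odd (suc (c + suc (suc c) * m)))))
                 (ℤP.*-comm (sign m) -1ℤ))
    where
    lem : ∀ m c → suc (suc (suc (c + c))) + suc (suc (suc (suc (c + c)))) * m
                  ≡ suc (suc (c + suc (suc c) * m) + suc (c + suc (suc c) * m))
    lem = ℕSolver.solve-∀

  sign-gonal⁻ : ∀ m → sign (gonal⁻ m) ≡ sign m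
  sign-gonal⁻ zero = refl
  sign-gonal⁻ (suc m) =
    trans (sign-+ (gonal⁻ m) (suc (w * m)))
          (trans (cong₂ _*ℤ_ (sign-gonal⁻ m) (trans (cong sign (cong suc (lem m c))) (sign-odd (suc (suc c) * m))))
                 (ℤP.*-comm (sign m) -1ℤ))
    where
    lem : ∀ m c → suc (suc (suc (suc (c + c)))) * m ≡ suc (suc c) * m + suc (suc c) * m
    lem = ℕSolver.solve-∀


module Counting (c : ℕ) where
  open import Data.Nat as ℕ using (zero; suc; _+_; _*_; _∸_; _<_; z≤n; s≤s)
  import Data.Nat.Properties as ℕP
  open import Data.Nat.Induction using (<-rec)
  open import Data.Nat.ListAction using (sum)
  open import Data.Integer as ℤ using (ℤ; +_; -1ℤ; -_; _-_; _^_) renaming (_+_ to _+ℤ_; _*_ to _*ℤ_)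
  import Data.Integer.Properties as ℤP
  open import Data.Integer.Tactic.RingSolver using (solve-∀)
  open import Data.List using (List; []; _∷_; length)
  open import Data.List.Relation.Unary.All as All using (All; []; _∷_)
  open import Data.Product using (Σ; _×_; _,_)
  open import Relation.Nullary using (yes; no)
  open import Relation.Binary.PropositionalEquality
  open import Function.Bundles using (mk⇔)
  open import Defs using (S; P; IsPartition; IsComposition; Enumerates; signedCount)
  open Series
  open Partitions
  open PartitionSeries
  open EvenPolygonal c
  open Compositions (P k) gonals gonals-positive gonals-unique gonals-sound gonals-complete P-positive

  -- theta n (toSeries g) has coefficient g n + thetaTail g n at q^n
  thetaTail : (ℕ → ℤ) → ℕ → ℤ
  thetaTail g n = sumℤ n (λ i → sign (suc i) *ℤ
    (toSeries g (+ n - + gonal⁺ (suc i)) +ℤ toSeries g (+ n - + gonal⁻ (suc i))))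

  -- theta · toSeries g = 1, read coefficientwise
  SatisfiesRecurrence : (ℕ → ℤ) → Set
  SatisfiesRecurrence g = ∀ n → g n +ℤ thetaTail g n ≡ 𝟙 (+ n)

  thetaTail-cong : ∀ g h n → (∀ m → m < n → g m ≡ h m) → thetaTail g n ≡ thetaTail h n
  thetaTail-cong g h n g≡h = sumℤ-cong n (λ i → cong (sign (suc i) *ℤ_)
    (cong₂ _+ℤ_ (toSeries-sub-cong g h n _ (ℕP.≤-trans (s≤s z≤n) (gonal⁺-≥ (suc i))) g≡h)
                (toSeries-sub-cong g h n _ (ℕP.≤-trans (s≤s z≤n) (gonal⁻-≥ (suc i))) g≡h)))

  recurrence-unique : ∀ g h → SatisfiesRecurrence g → SatisfiesRecurrence h → ∀ n → g n ≡ h n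
  recurrence-unique g h g-rec h-rec = <-rec (λ n → g n ≡ h n) step
    where
    cancel : ∀ a s → a ≡ a +ℤ s - s
    cancel = solve-∀
    step : ∀ n → (∀ {m} → m < n → g m ≡ h m) → g n ≡ h n
    step n below = begin
        g n                                  ≡⟨ cancel (g n) (thetaTail g n) ⟩
        g n +ℤ thetaTail g n - thetaTail g n ≡⟨ cong (_- thetaTail g n) (trans (g-rec n) (sym (h-rec n))) ⟩
        h n +ℤ thetaTail h n - thetaTail g n ≡⟨ cong (λ t → h n +ℤ t - thetaTail g n) (sym tails) ⟩
        h n +ℤ thetaTail g n - thetaTail g n ≡⟨ cancel (h n) (thetaTail g n) ⟨
        h n                                  ∎
      where
      open ≡-Reasoning
      tails = thetaTail-cong g h n (λ m m<n → below m<n)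

  partitionNumber : ℕ → ℤ
  partitionNumber m = partitionCount (sParts m) m

  partitions-sParts-stable : ∀ d M f m → m ℕ.≤ M → partitions f (sParts (d + M)) m ≡ partitions f (sParts M) m
  partitions-sParts-stable zero M f m m≤M = refl
  partitions-sParts-stable (suc d) M f m m≤M =
    trans (partitions-skip f _ _ m (ℕP.<-trans m<w*sD-1 (ℕP.<-trans (w*sD-1<w*sD) (ℕP.n<1+n _))))
    (trans (partitions-skip f _ _ m (ℕP.<-trans m<w*sD-1 w*sD-1<w*sD))
    (trans (partitions-skip f _ _ m m<w*sD-1) (partitions-sParts-stable d M f m m≤M)))
    where
    D = d + M
    m<w*sD-1 : m < w′ + w * D
    m<w*sD-1 = ℕP.≤-<-trans (ℕP.≤-trans m≤M (ℕP.≤-trans (ℕP.m≤n+m M d) (ℕP.m≤n*m D w)))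
                            (ℕP.m<n+m (w * D) {w′} (s≤s z≤n))
    w*sD-1<w*sD : w′ + w * D < w * suc D
    w*sD-1<w*sD = subst (w′ + w * D <_) (sym (ℕP.*-suc w D)) (ℕP.n<1+n _)

  partitionCount-sParts : ∀ n m → m ℕ.≤ n → partitionCount (sParts n) m ≡ partitionNumber m
  partitionCount-sParts n m m≤n =
    trans (cong (λ N → + length (partitions m (sParts N) m)) (sym (ℕP.m∸n+n≡m m≤n)))
          (cong (λ xss → + length xss) (partitions-sParts-stable (n ∸ m) m m m ℕP.≤-refl))

  -- Multiplying theta n (partitionSeries …) - 1 by the product over sParts n gives, by the truncated
  -- triple product, something vanishing below q^(n+1); the product can be cancelled.
  theta-partitionSeries : ∀ n → theta n (partitionSeries (sParts n)) (+ n) ≡ 𝟙 (+ n)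
  theta-partitionSeries n =
    trans (lem (X (+ n)) (𝟙 (+ n)))
          (trans (cong (_+ℤ 𝟙 (+ n)) (Y≈0 (+ n) (ℤ.+<+ (ℕP.n<1+n n)))) (ℤP.+-identityˡ _))
    where
    ps = sParts n
    X = theta n (partitionSeries ps)
    Y = X ⊕ ⊖ 𝟙
    lem : ∀ x d → x ≡ (x +ℤ - d) +ℤ d
    lem = solve-∀
    ΔY≈ : Δ∏ ps Y ≈ theta n 𝟙 ⊕ ⊖ Δ∏ ps 𝟙
    ΔY≈ = ≈-trans (Δ∏-⊕ ps X (⊖ 𝟙))
            (⊕-cong (≈-trans (Δ∏-theta n ps _) (theta-cong n (Δ∏-partitionSeries ps (sParts-positive n))))
                    (Δ∏-⊖ ps 𝟙))
    ΔY≈0 : Δ∏ ps Y ≈[< + suc n ] 𝟘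
    ΔY≈0 = ≈[<]-trans (≈⇒≈[<] ΔY≈)
             (≈[<]-trans (≈[<]-⊕ (≈⇒≈[<] (≈-refl {theta n 𝟙})) (≈[<]-⊖ (Δ∏-sParts≈[<]theta n)))
                         (≈⇒≈[<] (λ z → ℤP.+-inverseʳ (theta n 𝟙 z))))
    Y≈0 : Y ≈[< + suc n ] 𝟘
    Y≈0 = Δ∏-cancel ps (sParts-positive n) Y (+ suc n)
            (⊕-isPowerSeries (theta-isPowerSeries n (toSeries-isPowerSeries _)) (⊖-isPowerSeries 𝟙-isPowerSeries))
            ΔY≈0

  partitionNumber-recurrence : SatisfiesRecurrence partitionNumber
  partitionNumber-recurrence n =
    trans (cong (partitionNumber n +ℤ_)
                (thetaTail-cong partitionNumber (partitionCount (sParts n)) n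
                                (λ m m<n → sym (partitionCount-sParts n m (ℕP.<⇒≤ m<n)))))
          (theta-partitionSeries n)

  signedCompositionCount : ℕ → ℤ
  signedCompositionCount m = signedCount (compositions m m)

  alternatingCount : ℕ → ℤ
  alternatingCount m = sign m *ℤ signedCompositionCount m

  firstPartTerm-cong : ∀ g h n p → 1 ℕ.≤ p → (∀ x → x < n → g x ≡ h x) →
                       firstPartTerm g n p ≡ firstPartTerm h n p
  firstPartTerm-cong g h n p p≥1 g≡h with p ℕ.≤? n
  ... | yes p≤n = cong -_ (g≡h (n ∸ p) (ℕP.∸-monoʳ-< p≥1 p≤n))
  ... | no _ = refl

  firstPartSum-gonals : ∀ g n m → firstPartSum g n (gonals m)
                        ≡ sumℤ m (λ i → firstPartTerm g n (gonal⁺ (suc i)) +ℤ firstPartTerm g n (gonal⁻ (suc i)))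
  firstPartSum-gonals g n zero = refl
  firstPartSum-gonals g n (suc m) =
    trans (cong (λ t → firstPartTerm g n (gonal⁺ (suc m)) +ℤ (firstPartTerm g n (gonal⁻ (suc m)) +ℤ t))
                (firstPartSum-gonals g n m))
          (lem (firstPartTerm g n (gonal⁺ (suc m))) (firstPartTerm g n (gonal⁻ (suc m))) _)
    where
    lem : ∀ a b s → a +ℤ (b +ℤ s) ≡ s +ℤ (a +ℤ b)
    lem = solve-∀

  sign-firstPartTerm : ∀ n E → sign n *ℤ firstPartTerm signedCompositionCount n E
                               ≡ - (sign E *ℤ toSeries alternatingCount (+ n - + E))
  sign-firstPartTerm n E with E ℕ.≤? n
  ... | yes E≤n = begin
      sign n *ℤ - signedCompositionCount (n ∸ E)
    ≡⟨ cong (λ t → sign t *ℤ - signedCompositionCount (n ∸ E)) (sym (ℕP.m+[n∸m]≡n E≤n)) ⟩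
      sign (E + (n ∸ E)) *ℤ - signedCompositionCount (n ∸ E)
    ≡⟨ cong (_*ℤ - signedCompositionCount (n ∸ E)) (sign-+ E (n ∸ E)) ⟩
      sign E *ℤ sign (n ∸ E) *ℤ - signedCompositionCount (n ∸ E)
    ≡⟨ lem (sign E) (sign (n ∸ E)) (signedCompositionCount (n ∸ E)) ⟩
      - (sign E *ℤ alternatingCount (n ∸ E))
    ≡⟨ cong (λ t → - (sign E *ℤ t)) (toSeries-sub-≤ alternatingCount n E E≤n) ⟨
      - (sign E *ℤ toSeries alternatingCount (+ n - + E))
    ∎
    where
    open ≡-Reasoning
    lem : ∀ a b x → a *ℤ b *ℤ - x ≡ - (a *ℤ (b *ℤ x))
    lem = solve-∀
  ... | no E≰n = trans (ℤP.*-zeroʳ (sign n))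
    (sym (trans (cong (λ t → - (sign E *ℤ t)) (toSeries-sub-> alternatingCount n E (ℕP.≰⇒> E≰n)))
                (cong -_ (ℤP.*-zeroʳ (sign E)))))

  -- a composition of n > 0 is a first part E ∈ P_k followed by a composition of n - E
  alternatingCount-suc : ∀ n′ → alternatingCount (suc n′) ≡ - thetaTail alternatingCount (suc n′)
  alternatingCount-suc n′ = begin
      sign n *ℤ signedCount (extend (compositions n′) n (gonals n))
    ≡⟨ cong (sign n *ℤ_) (signedCount-extend (compositions n′) n (gonals n)) ⟩
      sign n *ℤ firstPartSum (λ x → signedCount (compositions n′ x)) n (gonals n)
    ≡⟨ cong (sign n *ℤ_) (firstPartSum-cong (gonals n) (gonals-positive n)) ⟩
      sign n *ℤ firstPartSum signedCompositionCount n (gonals n)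
    ≡⟨ cong (sign n *ℤ_) (firstPartSum-gonals signedCompositionCount n n) ⟩
      sign n *ℤ sumℤ n (λ i → term⁺ i +ℤ term⁻ i)
    ≡⟨ *-sumℤ n (sign n) _ ⟩
      sumℤ n (λ i → sign n *ℤ (term⁺ i +ℤ term⁻ i))
    ≡⟨ sumℤ-cong n signed ⟩
      sumℤ n (λ i → - (sign (suc i) *ℤ (value⁺ i +ℤ value⁻ i)))
    ≡⟨ neg-sumℤ n _ ⟨
      - thetaTail alternatingCount n
    ∎
    where
    open ≡-Reasoning
    n = suc n′
    term⁺ = λ i → firstPartTerm signedCompositionCount n (gonal⁺ (suc i))
    term⁻ = λ i → firstPartTerm signedCompositionCount n (gonal⁻ (suc i))
    value⁺ = λ i → toSeries alternatingCount (+ n - + gonal⁺ (suc i))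
    value⁻ = λ i → toSeries alternatingCount (+ n - + gonal⁻ (suc i))
    firstPartSum-cong : ∀ ps → All (1 ℕ.≤_) ps →
      firstPartSum (λ x → signedCount (compositions n′ x)) n ps ≡ firstPartSum signedCompositionCount n ps
    firstPartSum-cong [] _ = refl
    firstPartSum-cong (p ∷ ps) (p≥1 ∷ ps≥1) =
      cong₂ _+ℤ_ (firstPartTerm-cong _ _ n p p≥1
                    (λ x x<n → cong signedCount (compositions-fuel n′ x x (ℕP.≤-pred x<n) ℕP.≤-refl)))
                 (firstPartSum-cong ps ps≥1)
    lem : ∀ s a b → - (s *ℤ a) +ℤ - (s *ℤ b) ≡ - (s *ℤ (a +ℤ b))
    lem = solve-∀
    signed : ∀ i → sign n *ℤ (term⁺ i +ℤ term⁻ i) ≡ - (sign (suc i) *ℤ (value⁺ i +ℤ value⁻ i))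
    signed i = trans (ℤP.*-distribˡ-+ (sign n) _ _)
      (trans (cong₂ _+ℤ_ (trans (sign-firstPartTerm n (gonal⁺ (suc i)))
                                (cong (λ t → - (t *ℤ value⁺ i)) (sign-gonal⁺ (suc i))))
                         (trans (sign-firstPartTerm n (gonal⁻ (suc i)))
                                (cong (λ t → - (t *ℤ value⁻ i)) (sign-gonal⁻ (suc i)))))
             (lem (sign (suc i)) (value⁺ i) (value⁻ i)))

  alternatingCount-recurrence : SatisfiesRecurrence alternatingCount
  alternatingCount-recurrence zero = refl
  alternatingCount-recurrence (suc n) =
    trans (cong (_+ℤ thetaTail alternatingCount (suc n)) (alternatingCount-suc n))
          (ℤP.+-inverseˡ (thetaTail alternatingCount (suc n)))

  partitions-enumerate : ∀ n → Enumerates (IsPartition (S k) n) (partitions n (sParts n) n)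
  partitions-enumerate n =
    partitions-unique n (sParts n) n (sParts-descending n) , λ xs → mk⇔ (sound xs) (complete xs)
    where
    sound : ∀ xs → xs ∈ partitions n (sParts n) n → IsPartition (S k) n xs
    sound xs m with partitions-sound n (sParts n) n xs (sParts-descending n) m
    ... | l , a , s = l , All.map (sParts-sound n _) a , s
    parts≤sum : ∀ xs → All (ℕ._≤ sum xs) xs
    parts≤sum [] = []
    parts≤sum (x ∷ xs) =
      ℕP.m≤m+n x (sum xs) ∷ All.map (λ p → ℕP.≤-trans p (ℕP.m≤n+m (sum xs) x)) (parts≤sum xs)
    in-sParts : ∀ {x} → S k x × x ℕ.≤ n → x ∈ sParts n
    in-sParts {x} (Sx , x≤n) =
      sParts-complete n x Sx (ℕP.≤-trans x≤n (ℕP.≤-trans (ℕP.m≤n*m n w) (ℕP.n≤1+n _)))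
    complete : ∀ xs → IsPartition (S k) n xs → xs ∈ partitions n (sParts n) n
    complete xs (l , a , s) =
      partitions-complete n (sParts n) n xs (sParts-descending n) (sParts-positive n) ℕP.≤-refl
        (l , All.zipWith in-sParts (a , subst (λ t → All (ℕ._≤ t) xs) s (parts≤sum xs)) , s)

  compositions-enumerate : ∀ n → Enumerates (IsComposition (P k) n) (compositions n n)
  compositions-enumerate n =
    compositions-unique n n , λ xs → mk⇔ (compositions-sound n n xs) (compositions-complete n n xs ℕP.≤-refl)

  partitions-vs-compositions : ∀ n →
    Σ (List (List ℕ)) λ Ps → Σ (List (List ℕ)) λ Cs →
      Enumerates (IsPartition (S k) n) Ps × Enumerates (IsComposition (P k) n) Cs ×
      (+ length Ps ≡ (-1ℤ ^ n) *ℤ signedCount Cs)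
  partitions-vs-compositions n =
    partitions n (sParts n) n , compositions n n , partitions-enumerate n , compositions-enumerate n ,
    recurrence-unique partitionNumber alternatingCount partitionNumber-recurrence alternatingCount-recurrence n


module Parity where
  open import Data.Nat using (zero; suc; _+_; _*_; s≤s)
  open import Data.Nat.Divisibility using (_∣_; divides)
  open import Data.Product using (Σ; _,_)
  open import Relation.Binary.PropositionalEquality using (_≡_; refl)
  import Data.Nat.Tactic.RingSolver as ℕSolver

  even≥6 : ∀ k → 2 ∣ k → 6 ≤ k → Σ ℕ λ c → k ≡ 6 + (c + c)
  even≥6 _ (divides (suc (suc (suc c))) refl) _ = c , lem c
    where
    lem : ∀ c → suc (suc (suc c)) * 2 ≡ 6 + (c + c)
    lem = ℕSolver.solve-∀
  even≥6 _ (divides zero refl) ()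
  even≥6 _ (divides (suc zero) refl) (s≤s (s≤s ()))
  even≥6 _ (divides (suc (suc zero)) refl) (s≤s (s≤s (s≤s (s≤s ()))))


open import Defs
open import Data.Nat using (ℕ; _≤_)
open import Data.Nat.Divisibility using (_∣_)
open import Data.Integer using (ℤ; +_; -1ℤ; _*_; _^_)
open import Data.List using (List; length)
open import Data.Product using (Σ; _×_)
open import Relation.Binary.PropositionalEquality using (_≡_; refl)
open import Data.Product using (_,_)
open Parity using (even≥6)

theorem1p3 : (k : ℕ) → 2 ∣ k → 6 ≤ k → (n : ℕ) →
    Σ (List (List ℕ)) λ Ps → Σ (List (List ℕ)) λ Cs →
      Enumerates (IsPartition (S k) n) Ps ×
      Enumerates (IsComposition (P k) n) Cs ×
      (+ length Ps ≡ (-1ℤ ^ n) * signedCount Cs)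
theorem1p3 k 2∣k 6≤k n with even≥6 k 2∣k 6≤k
... | c , refl = Counting.partitions-vs-compositions c n
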